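{- Let $M$ be a partition matroid on a finite ground set $E$. Then there exists a total order $\preceq^\ast$ on $E$ such that the width of each of the BDDs $\mathsf{B}(\mathcal{I}(M))$, $\mathsf{B}(\mathcal{B}(M))$ and ZDDs $\mathsf{Z}(\mathcal{I}(M))$, $\mathsf{Z}(\mathcal{B}(M))$ with respect to $(E,\preceq^\ast)$ is at most $\mathrm{pw}(M)+1$.
   Context: $\mathcal{I}(M)$, $\mathcal{B}(M)$ are the collections of independent sets and bases. A partition matroid is a direct sum of uniform matroids (a uniform matroid of rank $r$ has as independent sets the subsets of size at most $r$; the direct sum of matroids on disjoint ground sets has independent sets $I_1\cup I_2$ with $I_j$ independent in the $j$-th summand). $r_M$ is the rank function, $\lambda_M(X)=r_M(X)+r_M(E\setminus X)-r_M(E)$, and the pathwidth is $\mathrm{pw}(M)=\min_{\preceq}\max_{i\in\{1,\ldots,n\}}\lambda_M(\{e_1,\ldots,e_i\})$, the minimum over total orders $\preceq$ on $E$ written as $e_1\prec\cdots\prec e_n$. Decision diagrams: for a total order $\preceq$ on $E$ and $\mathcal{S}\subseteq 2^E$, the BDD $\mathsf{B}(\mathcal{S})$ (resp. ZDD $\mathsf{Z}(\mathcal{S})$) is the directed acyclic graph obtained from the complete binary decision tree of $\mathcal{S}$ (internal nodes at depth $j$ labeled by the $(j+1)$-th smallest element of $E$, each with a 0-arc to $\nu_0$ and a 1-arc to $\nu_1$; the leaf reached by taking 1-arcs exactly at the elements of $X$ is the terminal $\top$ iff $X\in\mathcal{S}$, else $\bot$) by exhaustively applying: (NS) merge non-terminal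 nodes with the same label, same 0-successor and same 1-successor; and for BDDs remove every non-terminal $\nu$ with $\nu_0=\nu_1$, for ZDDs remove every non-terminal $\nu$ with $\nu_1=\bot$, redirecting arcs entering $\nu$ to $\nu_0$. If $e_1\prec\cdots\prec e_n$, the $i$-th width ($i\in\{0,\ldots,n-1\}$) is the number of non-terminal nodes labeled $e_{i+1}$, and the width is the maximum of these. -}

module Defs where

open import Data.Bool using (Bool; true; false; if_then_else_; _∧_; _∨_; not)
open import Data.Nat using (ℕ; zero; suc; _+_; _∸_; _⊔_; _≤_; _≤ᵇ_; _<ᵇ_)
open import Data.Fin using (Fin; toℕ) renaming (_≟_ to _≟F_)
open import Data.Fin.Permutation using (Permutation′; _⟨$⟩ʳ_; _⟨$⟩ˡ_)
open import Data.List using (List; []; _∷_; map; concatMap; filterᵇ; drop; length; foldr; upTo; allFin; deduplicateᵇ)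
open import Data.Vec using (Vec; []; _∷_; tabulate; replicate; _[_]≔_; zipWith)
open import Relation.Nullary.Decidable using (⌊_⌋)
open import Relation.Binary.PropositionalEquality using (_≡_)
open import Data.Product using (Σ; _×_)

-- Ground set E = Fin n; subsets of E are characteristic vectors,
-- families of subsets of E are Boolean predicates on them.

Subset : ℕ → Set
Subset n = Vec Bool n

Family : ℕ → Set
Family n = Subset n → Bool

allSubsets : (n : ℕ) → List (Subset n)
allSubsets zero    = [] ∷ []
allSubsets (suc n) = concatMap (λ v → (false ∷ v) ∷ (true ∷ v) ∷ []) (allSubsets n)

card : ∀ {n} → Subset n → ℕ
card []           = 0
card (true ∷ xs)  = suc (card xs)
card (false ∷ xs) = card xs

_⊆ᵇ_ : ∀ {n} → Subset n → Subset n → Bool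
[] ⊆ᵇ [] = true
(x ∷ xs) ⊆ᵇ (y ∷ ys) = (not x ∨ y) ∧ (xs ⊆ᵇ ys)

_==ᵇ_ : ∀ {n} → Subset n → Subset n → Bool
X ==ᵇ Y = (X ⊆ᵇ Y) ∧ (Y ⊆ᵇ X)

complement : ∀ {n} → Subset n → Subset n
complement = Data.Vec.map not

_∩_ : ∀ {n} → Subset n → Subset n → Subset n
_∩_ = zipWith _∧_

full : ∀ {n} → Subset n
full = replicate _ true

allᵇ : ∀ {A : Set} → (A → Bool) → List A → Bool
allᵇ p = foldr (λ x b → p x ∧ b) true

maxList : List ℕ → ℕ
maxList = foldr _⊔_ 0

-- Partition matroids: direct sum of uniform matroids.
-- Element e lies in block (blk e); block j is the uniform matroid of
-- rank (cap j) on its elements (independent = at most cap j elements).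

record PartitionMatroid (n : ℕ) : Set where
  field
    m   : ℕ
    blk : Fin n → Fin m
    cap : Fin m → ℕ

  block : Fin m → Subset n
  block j = tabulate (λ e → ⌊ blk e ≟F j ⌋)

  indep : Family n
  indep X = allᵇ (λ j → card (X ∩ block j) ≤ᵇ cap j) (allFin m)

rank : ∀ {n} → Family n → Subset n → ℕ
rank {n} I X = maxList (map (λ Y → if (Y ⊆ᵇ X) ∧ I Y then card Y else 0) (allSubsets n))

conn : ∀ {n} → Family n → Subset n → ℕ
conn I X = rank I X + rank I (complement X) ∸ rank I full

bases : ∀ {n} → Family n → Family n
bases {n} I X = I X ∧ allᵇ (λ Y → not ((X ⊆ᵇ Y) ∧ I Y) ∨ (Y ==ᵇ X)) (allSubsets n)

-- Total orders on E: a permutation σ with e_{j+1} = σ ⟨$⟩ʳ j.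

elt : ∀ {n} → Permutation′ n → Fin n → Fin n
elt σ j = σ ⟨$⟩ʳ j

order : ∀ {n} → Permutation′ n → List (Fin n)
order {n} σ = map (elt σ) (allFin n)

prefix : ∀ {n} → Permutation′ n → ℕ → Subset n
prefix σ i = tabulate (λ x → toℕ (σ ⟨$⟩ˡ x) <ᵇ i)

pwOf : ∀ {n} → Family n → Permutation′ n → ℕ
pwOf {n} I σ = maxList (map (λ i → conn I (prefix σ (suc i))) (upTo n))

IsPathwidth : ∀ {n} → Family n → ℕ → Set
IsPathwidth {n} I k = Σ (Permutation′ n) (λ σ → pwOf I σ ≡ k) × ((σ : Permutation′ n) → k ≤ pwOf I σ)

-- Nodes of the reduced diagram are represented
-- by the (hash-consed) sub-diagram they root: a node is identified by
-- its label and its two successors, which realises rule (NS).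

data DD (n : ℕ) : Set where
  ⊤N ⊥N : DD n
  node  : Fin n → DD n → DD n → DD n

eqDD : ∀ {n} → DD n → DD n → Bool
eqDD ⊤N ⊤N = true
eqDD ⊥N ⊥N = true
eqDD (node e a b) (node f c d) = ⌊ e ≟F f ⌋ ∧ eqDD a c ∧ eqDD b d
eqDD _ _ = false

data Kind : Set where
  BDD ZDD : Kind

-- create the node labelled e with 0-successor a and 1-successor b,
-- applying the BDD (ν₀ = ν₁) resp. ZDD (ν₁ = ⊥) deletion rule
mk : ∀ {n} → Kind → Fin n → DD n → DD n → DD n
mk BDD e a b = if eqDD a b then a else node e a b
mk ZDD e a b = if eqDD b ⊥N then a else node e a b

-- bottom-up reduction of the complete decision tree of S.
-- `red κ S es X` is the reduced node replacing the tree node whose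
-- remaining labels are es and at which the 1-arcs taken so far are X.
red : ∀ {n} → Kind → Family n → List (Fin n) → Subset n → DD n
red κ S []       X = if S X then ⊤N else ⊥N
red κ S (e ∷ es) X = mk κ e (red κ S es X) (red κ S es (X [ e ]≔ true))

-- the reduced nodes replacing the tree nodes at depth i
levelNodes : ∀ {n} → Kind → Family n → Permutation′ n → ℕ → List (DD n)
levelNodes {n} κ S σ i =
  map (red κ S (drop i (order σ))) (filterᵇ (λ X → X ⊆ᵇ prefix σ i) (allSubsets n))

labelledᵇ : ∀ {n} → Fin n → DD n → Bool
labelledᵇ e (node f _ _) = ⌊ e ≟F f ⌋
labelledᵇ e _ = false

-- i-th width: number of (distinct) non-terminal nodes labelled e_{i+1}
levelWidth : ∀ {n} → Kind → Family n → Permutation′ n → Fin n → ℕ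
levelWidth κ S σ i =
  length (deduplicateᵇ eqDD (filterᵇ (labelledᵇ (elt σ i)) (levelNodes κ S σ (toℕ i))))

ddWidth : ∀ {n} → Kind → Family n → Permutation′ n → ℕ
ddWidth {n} κ S σ = maxList (map (levelWidth κ S σ) (allFin n))

-- Sort E by blocks, so that every block B_j is an interval of the order.  At the level of an
-- element e ∈ B_j, a set X of earlier elements either violates an earlier block (its node is ⊥)
-- or leads to a node determined by s = |X ∩ B_j| alone, indeed only by how the constraint of
-- B_j reacts to z ≤ r further elements, r being the number of elements of B_j from e on.  For
-- independent sets (|X ∩ B_j| ≤ c) only max(s, c − r) matters; for bases, which are the sets
-- with |X ∩ B_j| = min(c, |B_j|) in every block, s itself.  Discarding the values of s whose
-- node is ⊥ or removed by the BDD resp. ZDD deletion rule leaves at most 1 + min(c, |B_j| − c)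
-- nodes labelled e.  Conversely, in every order some prefix X contains exactly c elements of
-- B_j, and λ_M(X) ≥ min(c, |B_j| − c): every independent Y can be traded for independent sets
-- inside X and inside E ∖ X with min(c, |B_j| − c) more elements in total.  Hence every level
-- has width at most pw(M) + 1.

module Submission where

open import Defs
open import Data.Bool using (Bool; true; false; T; not; _∧_; _∨_; if_then_else_)
import Data.Bool.Properties as Boolₚ
open import Data.Empty using (⊥; ⊥-elim)
open import Data.Fin using (Fin; zero; suc; toℕ; fromℕ<; punchOut) renaming (_≟_ to _≟F_)
open import Data.Fin.Permutation using (Permutation′; permutation; _⟨$⟩ʳ_; _⟨$⟩ˡ_; inverseˡ; inverseʳ)
import Data.Fin.Properties as Finₚ
open import Data.List using (List; []; _∷_; map; drop; tabulate; lookup; allFin; length; filterᵇ; deduplicateᵇ)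
import Data.List.Properties as Listₚ
open import Data.List.Relation.Unary.All as All using (All; []; _∷_)
import Data.List.Relation.Unary.All.Properties as Allₚ
open import Data.List.Relation.Unary.AllPairs using (AllPairs; []; _∷_)
import Data.List.Relation.Unary.AllPairs.Properties as AllPairsₚ
open import Data.List.Membership.Propositional using (_∈_)
import Data.List.Membership.Propositional.Properties as ∈ₚ
open import Data.List.Relation.Unary.Any as Any using (here; there)
open import Data.Nat
  using (ℕ; zero; suc; _≟_; _≤?_; _+_; _*_; _∸_; _⊔_; _⊓_; _≤_; _<_; z≤n; s≤s; _<ᵇ_; _≤ᵇ_; _≡ᵇ_)
open import Data.Nat.Properties
open import Data.Nat.Tactic.RingSolver using (solve-∀)
open import Data.Product using (Σ; ∃; _×_; _,_; proj₁; proj₂)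
open import Data.Sum using (_⊎_; inj₁; inj₂)
open import Data.Unit using (tt)
open import Data.Vec using (Vec; []; _∷_; zipWith; replicate; _[_]≔_)
  renaming (lookup to vlookup; tabulate to vtabulate)
open import Data.Vec.Functional using () renaming (_∷_ to _∷ᶠ_)
import Data.Vec.Properties as Vecₚ
open import Function using (id; _∘_; Equivalence)
open import Relation.Nullary using (¬_; yes; no)
open import Relation.Nullary.Decidable using (⌊_⌋)
open import Relation.Binary.PropositionalEquality
open import Relation.Binary.Definitions using (tri<; tri≈; tri>)

T⇒≡true : ∀ {b} → T b → b ≡ true
T⇒≡true = Equivalence.to Boolₚ.T-≡

≡true⇒T : ∀ {b} → b ≡ true → T b
≡true⇒T = Equivalence.from Boolₚ.T-≡

¬T⇒≡false : ∀ {b} → ¬ T b → b ≡ false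
¬T⇒≡false {true}  ¬t = ⊥-elim (¬t tt)
¬T⇒≡false {false} _  = refl

T-∧⁻ : ∀ {a b} → T (a ∧ b) → T a × T b
T-∧⁻ = Equivalence.to Boolₚ.T-∧

T-∧⁺ : ∀ {a b} → T a → T b → T (a ∧ b)
T-∧⁺ ta tb = Equivalence.from Boolₚ.T-∧ (ta , tb)

T-not⇒¬T : ∀ {b} → T (not b) → ¬ T b
T-not⇒¬T {true} () _

T-∨⁻ : ∀ {a b} → T (a ∨ b) → T a ⊎ T b
T-∨⁻ = Equivalence.to Boolₚ.T-∨

T-injective : ∀ {a b} → (T a → T b) → (T b → T a) → a ≡ b
T-injective {true}  {true}  _ _ = refl
T-injective {true}  {false} f _ = ⊥-elim (f tt)
T-injective {false} {true}  _ g = ⊥-elim (g tt)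
T-injective {false} {false} _ _ = refl

≮ᵇ⇒≥ : ∀ {a b} → T (not (a <ᵇ b)) → b ≤ a
≮ᵇ⇒≥ a≮b = ≮⇒≥ (λ a<b → subst (T ∘ not) (T⇒≡true (<⇒<ᵇ a<b)) a≮b)

≥⇒≮ᵇ : ∀ {a b} → b ≤ a → T (not (a <ᵇ b))
≥⇒≮ᵇ b≤a = subst (T ∘ not) (sym (¬T⇒≡false (λ a<b → <⇒≱ (<ᵇ⇒< _ _ a<b) b≤a))) tt

≟-refl : ∀ {n} (e : Fin n) → ⌊ e ≟F e ⌋ ≡ true
≟-refl e with e ≟F e
... | yes _ = refl
... | no e≢e = ⊥-elim (e≢e refl)

≟⇒≡ : ∀ {n} {x y : Fin n} → T ⌊ x ≟F y ⌋ → x ≡ y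
≟⇒≡ {x = x} {y} t with x ≟F y
... | yes x≡y = x≡y

-- Counting

bit : Bool → ℕ
bit true  = 1
bit false = 0

count : ∀ {n} → (Fin n → Bool) → ℕ
count {zero}  f = 0
count {suc n} f = bit (f zero) + count (f ∘ suc)

count-cong : ∀ {n} {f g : Fin n → Bool} → (∀ x → f x ≡ g x) → count f ≡ count g
count-cong {zero}  f≗g = refl
count-cong {suc n} f≗g = cong₂ _+_ (cong bit (f≗g zero)) (count-cong (f≗g ∘ suc))

count-mono : ∀ {n} {f g : Fin n → Bool} → (∀ x → T (f x) → T (g x)) → count f ≤ count g
count-mono {zero} f⊆g = z≤n
count-mono {suc n} {f} {g} f⊆g with f zero | g zero | f⊆g zero
... | true  | true  | _  = s≤s (count-mono (f⊆g ∘ suc))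
... | true  | false | ff = ⊥-elim (ff tt)
... | false | true  | _  = m≤n⇒m≤1+n (count-mono (f⊆g ∘ suc))
... | false | false | _  = count-mono (f⊆g ∘ suc)

count-<
  : ∀ {n} {f g : Fin n → Bool} → (∀ x → T (f x) → T (g x)) →
    (y : Fin n) → T (g y) → ¬ T (f y) → count f < count g
count-< {suc n} {f} {g} f⊆g zero gy ¬fy with f zero | g zero | f⊆g zero
... | true  | _     | _ = ⊥-elim (¬fy tt)
... | false | false | _ = ⊥-elim gy
... | false | true  | _ = s≤s (count-mono (f⊆g ∘ suc))
count-< {suc n} {f} {g} f⊆g (suc y) gy ¬fy with f zero | g zero | f⊆g zero
... | true  | true  | _  = s≤s (count-< (f⊆g ∘ suc) y gy ¬fy)
... | true  | false | ff = ⊥-elim (ff tt)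
... | false | true  | _  = m<n⇒m<1+n (count-< (f⊆g ∘ suc) y gy ¬fy)
... | false | false | _  = count-< (f⊆g ∘ suc) y gy ¬fy

count-∨ : ∀ {n} (f g : Fin n → Bool) → (∀ x → T (f x) → ¬ T (g x)) →
  count (λ x → f x ∨ g x) ≡ count f + count g
count-∨ {zero} f g disjoint = refl
count-∨ {suc n} f g disjoint with f zero | g zero | disjoint zero
... | true  | true  | d = ⊥-elim (d tt tt)
... | true  | false | _ = cong suc (count-∨ _ _ (disjoint ∘ suc))
... | false | true  | _ = trans (cong suc (count-∨ _ _ (disjoint ∘ suc))) (sym (+-suc _ _))
... | false | false | _ = count-∨ _ _ (disjoint ∘ suc)

count-split : ∀ {n} (f h : Fin n → Bool) →
  count f ≡ count (λ x → f x ∧ h x) + count (λ x → f x ∧ not (h x))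
count-split f h = trans (count-cong split) (count-∨ _ _ disjoint)
  where
  split : ∀ x → f x ≡ (f x ∧ h x) ∨ (f x ∧ not (h x))
  split x with f x | h x
  ... | true  | true  = refl
  ... | true  | false = refl
  ... | false | _     = refl
  disjoint : ∀ x → T (f x ∧ h x) → ¬ T (f x ∧ not (h x))
  disjoint x with f x | h x
  ... | true  | true  = λ _ ()
  ... | true  | false = λ ()
  ... | false | _     = λ ()

count-≡0 : ∀ {n} (f : Fin n → Bool) → (∀ x → f x ≡ false) → count f ≡ 0
count-≡0 {zero}  f f≗false = refl
count-≡0 {suc n} f f≗false rewrite f≗false zero = count-≡0 (f ∘ suc) (f≗false ∘ suc)

count-true : ∀ n → count {n} (λ _ → true) ≡ n
count-true zero    = refl
count-true (suc n) = cong suc (count-true n)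

count-≡-single : ∀ {n} (e : Fin n) (c : Bool) → count (λ x → ⌊ x ≟F e ⌋ ∧ c) ≡ bit c
count-≡-single {suc n} zero c =
  trans (cong (bit c +_) (count-≡0 {n} (λ x → ⌊ suc x ≟F zero ⌋ ∧ c) (λ _ → refl))) (+-identityʳ _)
count-≡-single {suc n} (suc e) c =
  trans (count-cong (λ x → cong (_∧ c) (suc-≟-suc x e))) (count-≡-single e c)
  where
  suc-≟-suc : ∀ {n} (x e : Fin n) → ⌊ suc x ≟F suc e ⌋ ≡ ⌊ x ≟F e ⌋
  suc-≟-suc x e with x ≟F e
  ... | yes _ = refl
  ... | no _  = refl

count-≤1 : ∀ {n} (f : Fin n → Bool) → (∀ x y → T (f x) → T (f y) → x ≡ y) → count f ≤ 1
count-≤1 {zero}  f unique = z≤n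
count-≤1 {suc n} f unique with f zero in f0
... | true  = ≤-reflexive (cong suc (count-≡0 (f ∘ suc) λ x →
  ¬T⇒≡false (λ t → Finₚ.0≢1+n (unique zero (suc x) (≡true⇒T f0) t))))
... | false = count-≤1 (f ∘ suc) (λ x y tx ty → Finₚ.suc-injective (unique (suc x) (suc y) tx ty))

∃⊆-count≡ : ∀ {n} (f : Fin n → Bool) (k : ℕ) → k ≤ count f →
  Σ (Fin n → Bool) (λ g → (∀ x → T (g x) → T (f x)) × count g ≡ k)
∃⊆-count≡ {zero} f zero _ = (λ _ → false) , (λ _ ()) , refl
∃⊆-count≡ {suc n} f k k≤ with f zero in f0
∃⊆-count≡ {suc n} f zero _ | true = (λ _ → false) , (λ _ ()) , count-≡0 {suc n} _ (λ _ → refl)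
∃⊆-count≡ {suc n} f (suc k) (s≤s k≤) | true with ∃⊆-count≡ (f ∘ suc) k k≤
... | g , g⊆f , #g = (true ∷ᶠ g) , sub , cong suc #g
  where
  sub : ∀ x → T ((true ∷ᶠ g) x) → T (f x)
  sub zero    _ = ≡true⇒T f0
  sub (suc x) t = g⊆f x t
∃⊆-count≡ {suc n} f k k≤ | false with ∃⊆-count≡ (f ∘ suc) k k≤
... | g , g⊆f , #g = (false ∷ᶠ g) , sub , #g
  where
  sub : ∀ x → T ((false ∷ᶠ g) x) → T (f x)
  sub (suc x) t = g⊆f x t

_∋_ : ∀ {n} → Subset n → Fin n → Set
X ∋ x = T (vlookup X x)

_⊆_ : ∀ {n} → Subset n → Subset n → Set
X ⊆ Y = ∀ x → X ∋ x → Y ∋ x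

_∪_ : ∀ {n} → Subset n → Subset n → Subset n
_∪_ = zipWith _∨_

∅ : ∀ {n} → Subset n
∅ = replicate _ false

lookup-ext : ∀ {n} {A : Set} (X Y : Vec A n) → (∀ i → vlookup X i ≡ vlookup Y i) → X ≡ Y
lookup-ext X Y X≗Y =
  trans (sym (Vecₚ.tabulate∘lookup X)) (trans (Vecₚ.tabulate-cong X≗Y) (Vecₚ.tabulate∘lookup Y))

∈-insert : ∀ {n} (X : Subset n) y → (X [ y ]≔ true) ∋ y
∈-insert X y = subst T (sym (Vecₚ.lookup∘update y X true)) tt

⊆-insert : ∀ {n} (X : Subset n) y → X ⊆ (X [ y ]≔ true)
⊆-insert X y x X∋x with x ≟F y
... | yes refl = ∈-insert X x
... | no x≢y   = subst T (sym (Vecₚ.lookup∘update′ x≢y X true)) X∋x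

card-count : ∀ {n} (X : Subset n) → card X ≡ count (vlookup X)
card-count []          = refl
card-count (true ∷ X)  = cong suc (card-count X)
card-count (false ∷ X) = card-count X

⊆ᵇ⇒⊆ : ∀ {n} (X Y : Subset n) → T (X ⊆ᵇ Y) → X ⊆ Y
⊆ᵇ⇒⊆ (true  ∷ X) (true  ∷ Y) t zero    _ = tt
⊆ᵇ⇒⊆ (true  ∷ X) (true  ∷ Y) t (suc i) u = ⊆ᵇ⇒⊆ X Y t i u
⊆ᵇ⇒⊆ (true  ∷ X) (false ∷ Y) () i
⊆ᵇ⇒⊆ (false ∷ X) (true  ∷ Y) t (suc i) u = ⊆ᵇ⇒⊆ X Y t i u
⊆ᵇ⇒⊆ (false ∷ X) (false ∷ Y) t (suc i) u = ⊆ᵇ⇒⊆ X Y t i u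

⊆⇒⊆ᵇ : ∀ {n} (X Y : Subset n) → X ⊆ Y → T (X ⊆ᵇ Y)
⊆⇒⊆ᵇ []          []          _   = tt
⊆⇒⊆ᵇ (true  ∷ X) (true  ∷ Y) X⊆Y = ⊆⇒⊆ᵇ X Y (X⊆Y ∘ suc)
⊆⇒⊆ᵇ (true  ∷ X) (false ∷ Y) X⊆Y = X⊆Y zero tt
⊆⇒⊆ᵇ (false ∷ X) (true  ∷ Y) X⊆Y = ⊆⇒⊆ᵇ X Y (X⊆Y ∘ suc)
⊆⇒⊆ᵇ (false ∷ X) (false ∷ Y) X⊆Y = ⊆⇒⊆ᵇ X Y (X⊆Y ∘ suc)

∈-allSubsets : ∀ {n} (X : Subset n) → X ∈ allSubsets n
∈-allSubsets []      = here refl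
∈-allSubsets (x ∷ X) =
  ∈ₚ.∈-concatMap⁺ (λ v → (false ∷ v) ∷ (true ∷ v) ∷ []) (Any.map (λ { refl → head-∈ x }) (∈-allSubsets X))
  where
  head-∈ : ∀ b → (b ∷ X) ∈ ((false ∷ X) ∷ (true ∷ X) ∷ [])
  head-∈ false = here refl
  head-∈ true  = there (here refl)

module _ {A : Set} {p q : A → Bool} where

  allᵇ-cong : (xs : List A) → (∀ x → x ∈ xs → p x ≡ q x) → allᵇ p xs ≡ allᵇ q xs
  allᵇ-cong []       _   = refl
  allᵇ-cong (x ∷ xs) p≗q = cong₂ _∧_ (p≗q x (here refl)) (allᵇ-cong xs (λ y y∈ → p≗q y (there y∈)))

module _ {A : Set} {p : A → Bool} where

  allᵇ⁺ : (xs : List A) → (∀ x → x ∈ xs → p x ≡ true) → allᵇ p xs ≡ true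
  allᵇ⁺ []       _   = refl
  allᵇ⁺ (x ∷ xs) all rewrite all x (here refl) = allᵇ⁺ xs (λ y y∈ → all y (there y∈))

  allᵇ⁻ : (xs : List A) → allᵇ p xs ≡ true → ∀ x → x ∈ xs → p x ≡ true
  allᵇ⁻ (y ∷ xs) all x x∈ with p y in py
  allᵇ⁻ (y ∷ xs) all x (here refl) | true = py
  allᵇ⁻ (y ∷ xs) all x (there x∈)  | true = allᵇ⁻ xs all x x∈

  allᵇ-false⁺ : (xs : List A) (x : A) → x ∈ xs → p x ≡ false → allᵇ p xs ≡ false
  allᵇ-false⁺ (y ∷ xs) x (here refl) px rewrite px = refl
  allᵇ-false⁺ (y ∷ xs) x (there x∈)  px =
    trans (cong (p y ∧_) (allᵇ-false⁺ xs x x∈ px)) (Boolₚ.∧-zeroʳ (p y))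

≤-maxList : ∀ (xs : List ℕ) x → x ∈ xs → x ≤ maxList xs
≤-maxList (y ∷ xs) x (here refl) = m≤m⊔n y _
≤-maxList (y ∷ xs) x (there x∈)  = ≤-trans (≤-maxList xs x x∈) (m≤n⊔m y _)

maxList-≤ : ∀ (xs : List ℕ) b → (∀ x → x ∈ xs → x ≤ b) → maxList xs ≤ b
maxList-≤ []       b _   = z≤n
maxList-≤ (y ∷ xs) b all = ⊔-lub (all y (here refl)) (maxList-≤ xs b (λ x x∈ → all x (there x∈)))

drop-tabulate : ∀ {n} {A : Set} (f : Fin n → A) (i : Fin n) →
  drop (toℕ i) (tabulate f) ≡ f i ∷ drop (suc (toℕ i)) (tabulate f)
drop-tabulate {suc n} f zero    = refl
drop-tabulate {suc n} f (suc i) = drop-tabulate (f ∘ suc) i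

∈-drop-tabulate : ∀ {n} {A : Set} (f : Fin n → A) q x → x ∈ drop q (tabulate f) →
  ∃ λ p → q ≤ toℕ p × x ≡ f p
∈-drop-tabulate {suc n} f zero x (here refl) = zero , z≤n , refl
∈-drop-tabulate {suc n} f zero x (there x∈) with ∈-drop-tabulate (f ∘ suc) zero x x∈
... | p , _ , x≡ = suc p , z≤n , x≡
∈-drop-tabulate {suc n} f (suc q) x x∈ with ∈-drop-tabulate (f ∘ suc) q x x∈
... | p , q≤p , x≡ = suc p , s≤s q≤p , x≡

deduplicateᵇ-distinct : ∀ {A : Set} (r : A → A → Bool) → (∀ a → r a a ≡ true) →
  ∀ zs → AllPairs _≢_ (deduplicateᵇ r zs)
deduplicateᵇ-distinct r r-refl []       = []
deduplicateᵇ-distinct r r-refl (z ∷ zs) =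
  All.map (λ ¬z≈ z≡ → ¬z≈ (subst (T ∘ r z) z≡ (≡true⇒T (r-refl z)))) (Allₚ.all-filter _ (deduplicateᵇ r zs))
  ∷ AllPairsₚ.filter⁺ _ (deduplicateᵇ-distinct r r-refl zs)

distinct⇒lookup-injective : ∀ {A : Set} {zs : List A} → AllPairs _≢_ zs →
  ∀ i j → lookup zs i ≡ lookup zs j → i ≡ j
distinct⇒lookup-injective (_ ∷ _)  zero    zero    _  = refl
distinct⇒lookup-injective (h ∷ _)  zero    (suc j) z≡ = ⊥-elim (All.lookup h (∈ₚ.∈-lookup j) z≡)
distinct⇒lookup-injective (h ∷ _)  (suc i) zero    z≡ = ⊥-elim (All.lookup h (∈ₚ.∈-lookup i) (sym z≡))
distinct⇒lookup-injective (_ ∷ hs) (suc i) (suc j) z≡ = cong suc (distinct⇒lookup-injective hs i j z≡)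

-- Reduced decision diagrams

eqDD-refl : ∀ {n} (a : DD n) → eqDD a a ≡ true
eqDD-refl ⊤N = refl
eqDD-refl ⊥N = refl
eqDD-refl (node e a b) rewrite ≟-refl e | eqDD-refl a | eqDD-refl b = refl

eqDD-sound : ∀ {n} (a b : DD n) → T (eqDD a b) → a ≡ b
eqDD-sound ⊤N ⊤N _ = refl
eqDD-sound ⊥N ⊥N _ = refl
eqDD-sound (node e a b) (node f c d) t with e ≟F f | eqDD a c in a≈c | eqDD b d in b≈d
... | yes refl | true | true =
  cong₂ (node e) (eqDD-sound a c (≡true⇒T a≈c)) (eqDD-sound b d (≡true⇒T b≈d))
eqDD-sound ⊤N ⊥N ()
eqDD-sound ⊤N (node _ _ _) ()
eqDD-sound ⊥N ⊤N ()
eqDD-sound ⊥N (node _ _ _) ()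
eqDD-sound (node _ _ _) ⊤N ()
eqDD-sound (node _ _ _) ⊥N ()

mk-BDD-≡ : ∀ {n} (e : Fin n) a → mk BDD e a a ≡ a
mk-BDD-≡ e a rewrite eqDD-refl a = refl

mk-ZDD-⊥N : ∀ {n} (e : Fin n) a → mk ZDD e a ⊥N ≡ a
mk-ZDD-⊥N e a = refl

SupportedIn : ∀ {n} → List (Fin n) → Subset n → Set
SupportedIn es Z = ∀ x → Z ∋ x → x ∈ es

∅-supported : ∀ {n} (es : List (Fin n)) → SupportedIn es ∅
∅-supported es x ∅∋x = ⊥-elim (subst T (Vecₚ.lookup-replicate x false) ∅∋x)

∪-∅ : ∀ {n} (X : Subset n) → X ∪ ∅ ≡ X
∪-∅ []      = refl
∪-∅ (x ∷ X) = cong₂ _∷_ (Boolₚ.∨-identityʳ x) (∪-∅ X)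

insert-∪ : ∀ {n} (X Z : Subset n) (e : Fin n) → (X [ e ]≔ true) ∪ Z ≡ X ∪ (Z [ e ]≔ true)
insert-∪ X Z e = lookup-ext _ _ pointwise
  where
  pointwise : ∀ i → vlookup ((X [ e ]≔ true) ∪ Z) i ≡ vlookup (X ∪ (Z [ e ]≔ true)) i
  pointwise i
    rewrite Vecₚ.lookup-zipWith _∨_ i (X [ e ]≔ true) Z | Vecₚ.lookup-zipWith _∨_ i X (Z [ e ]≔ true)
    with i ≟F e
  ... | yes refl rewrite Vecₚ.lookup∘update i X true | Vecₚ.lookup∘update i Z true =
    sym (Boolₚ.∨-zeroʳ (vlookup X i))
  ... | no i≢e rewrite Vecₚ.lookup∘update′ i≢e X true | Vecₚ.lookup∘update′ i≢e Z true = refl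

insert-supported : ∀ {n} (e : Fin n) es Z → SupportedIn es Z → SupportedIn (e ∷ es) (Z [ e ]≔ true)
insert-supported e es Z supp x Z∋x with x ≟F e
... | yes refl = here refl
... | no x≢e   = there (supp x (subst T (Vecₚ.lookup∘update′ x≢e Z true) Z∋x))

red-cong : ∀ {n} κ (S : Family n) es (X X′ : Subset n) →
  (∀ Z → SupportedIn es Z → S (X ∪ Z) ≡ S (X′ ∪ Z)) → red κ S es X ≡ red κ S es X′
red-cong κ S [] X X′ same = cong (λ b → if b then ⊤N else ⊥N) (begin
  S X         ≡⟨ cong S (∪-∅ X) ⟨
  S (X ∪ ∅)   ≡⟨ same ∅ (∅-supported []) ⟩
  S (X′ ∪ ∅)  ≡⟨ cong S (∪-∅ X′) ⟩
  S X′        ∎)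
  where open ≡-Reasoning
red-cong κ S (e ∷ es) X X′ same = cong₂ (mk κ e)
  (red-cong κ S es X X′ (λ Z supp → same Z (λ x Z∋x → there (supp x Z∋x))))
  (red-cong κ S es (X [ e ]≔ true) (X′ [ e ]≔ true) λ Z supp → begin
    S ((X [ e ]≔ true) ∪ Z)   ≡⟨ cong S (insert-∪ X Z e) ⟩
    S (X ∪ (Z [ e ]≔ true))   ≡⟨ same (Z [ e ]≔ true) (insert-supported e es Z supp) ⟩
    S (X′ ∪ (Z [ e ]≔ true))  ≡⟨ cong S (insert-∪ X′ Z e) ⟨
    S ((X′ [ e ]≔ true) ∪ Z)  ∎)
  where open ≡-Reasoning

red-≡⊥N : ∀ {n} κ (S : Family n) es (X : Subset n) →
  (∀ Z → SupportedIn es Z → S (X ∪ Z) ≡ false) → red κ S es X ≡ ⊥N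
red-≡⊥N κ S [] X empty =
  cong (λ b → if b then ⊤N else ⊥N) (trans (cong S (sym (∪-∅ X))) (empty ∅ (∅-supported [])))
red-≡⊥N κ S (e ∷ es) X empty
  rewrite red-≡⊥N κ S es X (λ Z supp → empty Z (λ x Z∋x → there (supp x Z∋x)))
        | red-≡⊥N κ S es (X [ e ]≔ true)
            (λ Z supp → trans (cong S (insert-∪ X Z e)) (empty (Z [ e ]≔ true) (insert-supported e es Z supp)))
  with κ
... | BDD = refl
... | ZDD = refl

red-unlabelled : ∀ {n} κ (S : Family n) es (X : Subset n) (e : Fin n) → ¬ e ∈ es →
  labelledᵇ e (red κ S es X) ≡ false
red-unlabelled κ S [] X e _ with S X
... | true  = refl
... | false = refl
red-unlabelled BDD S (f ∷ es) X e e∉ with eqDD (red BDD S es X) (red BDD S es (X [ f ]≔ true))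
... | true = red-unlabelled BDD S es X e (e∉ ∘ there)
... | false with e ≟F f
...   | yes refl = ⊥-elim (e∉ (here refl))
...   | no _     = refl
red-unlabelled ZDD S (f ∷ es) X e e∉ with eqDD (red ZDD S es (X [ f ]≔ true)) ⊥N
... | true = red-unlabelled ZDD S es X e (e∉ ∘ there)
... | false with e ≟F f
...   | yes refl = ⊥-elim (e∉ (here refl))
...   | no _     = refl

red-resp-≗ : ∀ {n} κ (S S′ : Family n) es X → (∀ Y → S Y ≡ S′ Y) → red κ S es X ≡ red κ S′ es X
red-resp-≗ κ S S′ []       X S≗S′ rewrite S≗S′ X = refl
red-resp-≗ κ S S′ (e ∷ es) X S≗S′ =
  cong₂ (mk κ e) (red-resp-≗ κ S S′ es X S≗S′) (red-resp-≗ κ S S′ es _ S≗S′)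

levelWidth-resp-≗ : ∀ {n} κ (S S′ : Family n) σ i → (∀ Y → S Y ≡ S′ Y) →
  levelWidth κ S σ i ≡ levelWidth κ S′ σ i
levelWidth-resp-≗ {n} κ S S′ σ i S≗S′ =
  cong (λ nodes → length (deduplicateᵇ eqDD (filterᵇ (labelledᵇ (elt σ i)) nodes)))
    (Listₚ.map-cong (λ X → red-resp-≗ κ S S′ (drop (toℕ i) (order σ)) X S≗S′)
      (filterᵇ (λ X → X ⊆ᵇ prefix σ (toℕ i)) (allSubsets n)))

ddWidth-≤ : ∀ {n} κ (S : Family n) σ b → (∀ i → levelWidth κ S σ i ≤ b) → ddWidth κ S σ ≤ b
ddWidth-≤ {n} κ S σ b bounded = maxList-≤ (map (levelWidth κ S σ) (allFin n)) b λ w w∈ →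
  let (i , _ , w≡) = ∈ₚ.∈-map⁻ (levelWidth κ S σ) w∈ in subst (_≤ b) (sym w≡) (bounded i)

distinctNodes-≤ : ∀ {n} {A : Set} (val : A → DD n) (key : A → ℕ) (lab : DD n → Bool) (lo hi : ℕ)
  (xs : List A) →
  (∀ a → a ∈ xs → T (lab (val a)) → lo ≤ key a × key a < hi) →
  (∀ a a′ → a ∈ xs → a′ ∈ xs → T (lab (val a)) → T (lab (val a′)) → key a ≡ key a′ → val a ≡ val a′) →
  length (deduplicateᵇ eqDD (filterᵇ lab (map val xs))) ≤ hi ∸ lo
distinctNodes-≤ {n} {A} val key lab lo hi xs inRange keyDetermines = Finₚ.injective⇒≤ injective
  where
  ys = deduplicateᵇ eqDD (filterᵇ lab (map val xs))

  Witnessed : DD n → Set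
  Witnessed y = Σ A λ a → a ∈ xs × T (lab (val a)) × val a ≡ y

  filter-witnessed : ∀ as → (∀ {a} → a ∈ as → a ∈ xs) → All Witnessed (filterᵇ lab (map val as))
  filter-witnessed [] _ = []
  filter-witnessed (a ∷ as) ⊆xs with lab (val a) in la
  ... | true  = (a , ⊆xs (here refl) , ≡true⇒T la , refl) ∷ filter-witnessed as (⊆xs ∘ there)
  ... | false = filter-witnessed as (⊆xs ∘ there)

  witness : (i : Fin (length ys)) → Witnessed (lookup ys i)
  witness i = All.lookup (Allₚ.deduplicate⁺ _ (filter-witnessed xs id)) (∈ₚ.∈-lookup i)

  range : ∀ i → lo ≤ key (proj₁ (witness i)) × key (proj₁ (witness i)) < hi
  range i = let (a , a∈ , la , _) = witness i in inRange a a∈ la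

  distinct : AllPairs _≢_ ys
  distinct = deduplicateᵇ-distinct eqDD eqDD-refl (filterᵇ lab (map val xs))

  slot : Fin (length ys) → Fin (hi ∸ lo)
  slot i = fromℕ< (∸-monoˡ-< (proj₂ (range i)) (proj₁ (range i)))

  injective : ∀ {i j} → slot i ≡ slot j → i ≡ j
  injective {i} {j} slot≡ = distinct⇒lookup-injective distinct i j (begin
      lookup ys i  ≡⟨ proj₂ (proj₂ (proj₂ (witness i))) ⟨
      val a        ≡⟨ keyDetermines a a′ a∈ a′∈ la la′ key≡ ⟩
      val a′       ≡⟨ proj₂ (proj₂ (proj₂ (witness j))) ⟩
      lookup ys j  ∎)
    where
    open ≡-Reasoning
    a = proj₁ (witness i)
    a′ = proj₁ (witness j)
    a∈ = proj₁ (proj₂ (witness i))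
    a′∈ = proj₁ (proj₂ (witness j))
    la = proj₁ (proj₂ (proj₂ (witness i)))
    la′ = proj₁ (proj₂ (proj₂ (witness j)))
    key≡ : key a ≡ key a′
    key≡ = begin
      key a            ≡⟨ m∸n+n≡m (proj₁ (range i)) ⟨
      key a ∸ lo + lo  ≡⟨ cong (_+ lo) offset≡ ⟩
      key a′ ∸ lo + lo ≡⟨ m∸n+n≡m (proj₁ (range j)) ⟩
      key a′           ∎
      where
      offset≡ : key a ∸ lo ≡ key a′ ∸ lo
      offset≡ = trans (sym (Finₚ.toℕ-fromℕ< _)) (trans (cong toℕ slot≡) (Finₚ.toℕ-fromℕ< _))

-- Block-sorted orders

position : ∀ {n} → Permutation′ n → Fin n → ℕ
position σ x = toℕ (σ ⟨$⟩ˡ x)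

BlockSorted : ∀ {n m} → (Fin n → Fin m) → Permutation′ n → Set
BlockSorted blk σ = ∀ x y → toℕ (blk x) < toℕ (blk y) → position σ x < position σ y

injective⇒surjective : ∀ {n} (f : Fin n → Fin n) → (∀ {x y} → f x ≡ f y → x ≡ y) →
  ∀ p → ∃ λ x → f x ≡ p
injective⇒surjective {suc k} f f-inj p with Finₚ.any? (λ x → f x Finₚ.≟ p)
... | yes hit = hit
... | no miss = ⊥-elim (<-irrefl refl (Finₚ.injective⇒≤ avoid-injective))
  where
  avoid : Fin (suc k) → Fin k
  avoid x = punchOut {i = p} {j = f x} (λ p≡ → miss (x , sym p≡))
  avoid-injective : ∀ {x y} → avoid x ≡ avoid y → x ≡ y
  avoid-injective {x} {y} avoid≡ =
    f-inj (Finₚ.punchOut-injective (λ p≡ → miss (x , sym p≡)) (λ p≡ → miss (y , sym p≡)) avoid≡)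

module SortBy {n : ℕ} (key : Fin n → ℕ) (key-injective : ∀ {x y} → key x ≡ key y → x ≡ y) where

  rankℕ : Fin n → ℕ
  rankℕ x = count (λ y → key y <ᵇ key x)

  rankℕ-< : ∀ {x y} → key x < key y → rankℕ x < rankℕ y
  rankℕ-< {x} {y} kx<ky =
    count-< (λ z kz<kx → <⇒<ᵇ (<-trans (<ᵇ⇒< _ _ kz<kx) kx<ky)) x (<⇒<ᵇ kx<ky)
      (λ kx<kx → <-irrefl refl (<ᵇ⇒< (key x) (key x) kx<kx))

  rankℕ<n : ∀ x → rankℕ x < n
  rankℕ<n x = subst (rankℕ x <_) (count-true n)
    (count-< (λ _ _ → tt) x tt (λ kx<kx → <-irrefl refl (<ᵇ⇒< (key x) (key x) kx<kx)))

  rankFin : Fin n → Fin n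
  rankFin x = fromℕ< (rankℕ<n x)

  rankFin-injective : ∀ {x y} → rankFin x ≡ rankFin y → x ≡ y
  rankFin-injective {x} {y} r≡ = key-injective (≤-antisym
    (≮⇒≥ (λ k> → <-irrefl (sym rank≡) (rankℕ-< k>))) (≮⇒≥ (λ k< → <-irrefl rank≡ (rankℕ-< k<))))
    where
    rank≡ : rankℕ x ≡ rankℕ y
    rank≡ = trans (sym (Finₚ.toℕ-fromℕ< _)) (trans (cong toℕ r≡) (Finₚ.toℕ-fromℕ< _))

  rankFin-surjective : ∀ p → ∃ λ x → rankFin x ≡ p
  rankFin-surjective = injective⇒surjective rankFin rankFin-injective

  sorted : Permutation′ n
  sorted = permutation (proj₁ ∘ rankFin-surjective) rankFin
    (λ x → rankFin-injective (proj₂ (rankFin-surjective (rankFin x))))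
    (proj₂ ∘ rankFin-surjective)

  sorted-< : ∀ x y → key x < key y → position sorted x < position sorted y
  sorted-< x y kx<ky = subst₂ _<_ (sym (Finₚ.toℕ-fromℕ< _)) (sym (Finₚ.toℕ-fromℕ< _)) (rankℕ-< kx<ky)

blockSorted : ∀ {n m} (blk : Fin n → Fin m) → Σ (Permutation′ n) (BlockSorted blk)
blockSorted {n} blk = sorted , λ x y b< → sorted-< x y (blockKey-< x y b<)
  where
  blockKey : Fin n → ℕ
  blockKey x = toℕ (blk x) * n + toℕ x

  blockKey-< : ∀ x y → toℕ (blk x) < toℕ (blk y) → blockKey x < blockKey y
  blockKey-< x y b< = begin-strict
    toℕ (blk x) * n + toℕ x  <⟨ +-monoʳ-< (toℕ (blk x) * n) (Finₚ.toℕ<n x) ⟩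
    toℕ (blk x) * n + n      ≡⟨ +-comm (toℕ (blk x) * n) n ⟩
    suc (toℕ (blk x)) * n    ≤⟨ *-monoˡ-≤ n b< ⟩
    toℕ (blk y) * n          ≤⟨ m≤m+n _ _ ⟩
    blockKey y               ∎
    where open ≤-Reasoning

  blockKey-injective : ∀ {x y} → blockKey x ≡ blockKey y → x ≡ y
  blockKey-injective {x} {y} k≡ with <-cmp (toℕ (blk x)) (toℕ (blk y))
  ... | tri< b< _ _ = ⊥-elim (<-irrefl k≡ (blockKey-< x y b<))
  ... | tri> _ _ b> = ⊥-elim (<-irrefl (sym k≡) (blockKey-< y x b>))
  ... | tri≈ _ b≡ _ = Finₚ.toℕ-injective
    (+-cancelˡ-≡ (toℕ (blk x) * n) _ _ (trans k≡ (cong (λ b → b * n + toℕ y) (sym b≡))))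

  open SortBy blockKey blockKey-injective

-- Bases

bases⇒maximal : ∀ {n} (I : Family n) X → T (bases I X) → ∀ Y → X ⊆ Y → I Y ≡ true → Y ⊆ X
bases⇒maximal {n} I X isBasis Y X⊆Y IY = ⊆ᵇ⇒⊆ Y X (proj₁ (T-∧⁻ Y==X))
  where
  entry : not ((X ⊆ᵇ Y) ∧ I Y) ∨ (Y ==ᵇ X) ≡ true
  entry = allᵇ⁻ (allSubsets n) (T⇒≡true (proj₂ (T-∧⁻ isBasis))) Y (∈-allSubsets Y)
  Y==X : T (Y ==ᵇ X)
  Y==X = subst₂ (λ a b → T (not (a ∧ b) ∨ (Y ==ᵇ X))) (T⇒≡true (⊆⇒⊆ᵇ X Y X⊆Y)) IY (≡true⇒T entry)

maximal⇒bases : ∀ {n} (I : Family n) X → I X ≡ true → (∀ Y → X ⊆ Y → I Y ≡ true → Y ⊆ X) → T (bases I X)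
maximal⇒bases {n} I X IX maximal = T-∧⁺ (≡true⇒T IX) (≡true⇒T (allᵇ⁺ (allSubsets n) checkY))
  where
  checkY : ∀ Y → Y ∈ allSubsets n → not ((X ⊆ᵇ Y) ∧ I Y) ∨ (Y ==ᵇ X) ≡ true
  checkY Y _ with X ⊆ᵇ Y in X⊆ᵇY | I Y in IY
  ... | false | _     = refl
  ... | true  | false = refl
  ... | true  | true  = T⇒≡true (T-∧⁺ (⊆⇒⊆ᵇ Y X (maximal Y (⊆ᵇ⇒⊆ X Y (≡true⇒T X⊆ᵇY)) IY)) tt)

module Blocks {n : ℕ} (M : PartitionMatroid n) where
  open PartitionMatroid M public

  inBlock : Fin n → Fin m → Bool
  inBlock x l = ⌊ blk x ≟F l ⌋

  countIn : Subset n → Fin m → ℕ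
  countIn X l = count (λ x → vlookup X x ∧ inBlock x l)

  card-∩-block : ∀ X l → card (X ∩ block l) ≡ countIn X l
  card-∩-block X l = trans (card-count (X ∩ block l)) (count-cong λ x →
    trans (Vecₚ.lookup-zipWith _∧_ x X (block l)) (cong (vlookup X x ∧_) (Vecₚ.lookup∘tabulate _ x)))

  card-block : ∀ l → card (block l) ≡ count (λ x → inBlock x l)
  card-block l = trans (card-count (block l)) (count-cong (Vecₚ.lookup∘tabulate (λ x → inBlock x l)))

  countIn-≤-block : ∀ X l → countIn X l ≤ card (block l)
  countIn-≤-block X l = subst (countIn X l ≤_) (sym (card-block l))
    (count-mono (λ x t → proj₂ (T-∧⁻ {vlookup X x} t)))

  countIn-insert : ∀ X y l → vlookup X y ≡ false →
    countIn (X [ y ]≔ true) l ≡ countIn X l + bit (inBlock y l)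
  countIn-insert X y l X∌y =
    trans (count-cong split)
      (trans (count-∨ _ _ disjoint) (cong (countIn X l +_) (count-≡-single y (inBlock y l))))
    where
    split : ∀ x → vlookup (X [ y ]≔ true) x ∧ inBlock x l
                ≡ (vlookup X x ∧ inBlock x l) ∨ (⌊ x ≟F y ⌋ ∧ inBlock y l)
    split x with x ≟F y
    ... | yes refl rewrite Vecₚ.lookup∘update x X true | X∌y = refl
    ... | no x≢y   rewrite Vecₚ.lookup∘update′ x≢y X true = sym (Boolₚ.∨-identityʳ _)
    disjoint : ∀ x → T (vlookup X x ∧ inBlock x l) → ¬ T (⌊ x ≟F y ⌋ ∧ inBlock y l)
    disjoint x X∋x with x ≟F y
    ... | yes refl rewrite X∌y = λ _ → X∋x
    ... | no _     = λ ()

  indep⇒≤cap : ∀ X → indep X ≡ true → ∀ l → countIn X l ≤ cap l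
  indep⇒≤cap X IX l =
    subst (_≤ cap l) (card-∩-block X l) (≤ᵇ⇒≤ _ _ (≡true⇒T (allᵇ⁻ (allFin m) IX l (∈ₚ.∈-allFin l))))

  ≤cap⇒indep : ∀ X → (∀ l → countIn X l ≤ cap l) → indep X ≡ true
  ≤cap⇒indep X ≤cap = allᵇ⁺ (allFin m) λ l _ →
    T⇒≡true (≤⇒≤ᵇ (subst (_≤ cap l) (sym (card-∩-block X l)) (≤cap l)))

  countFamily : (Fin m → ℕ → Bool) → Family n
  countFamily φ X = allᵇ (λ l → φ l (card (X ∩ block l))) (allFin m)

  countIn-∪ : ∀ X Z l → (∀ x → X ∋ x → ¬ Z ∋ x) → countIn (X ∪ Z) l ≡ countIn X l + countIn Z l
  countIn-∪ X Z l disjoint = trans (count-cong split) (count-∨ _ _ disjoint′)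
    where
    split : ∀ x → vlookup (X ∪ Z) x ∧ inBlock x l ≡ (vlookup X x ∧ inBlock x l) ∨ (vlookup Z x ∧ inBlock x l)
    split x rewrite Vecₚ.lookup-zipWith _∨_ x X Z = Boolₚ.∧-distribʳ-∨ (inBlock x l) (vlookup X x) (vlookup Z x)
    disjoint′ : ∀ x → T (vlookup X x ∧ inBlock x l) → ¬ T (vlookup Z x ∧ inBlock x l)
    disjoint′ x X∋x Z∋x = disjoint x (proj₁ (T-∧⁻ X∋x)) (proj₁ (T-∧⁻ Z∋x))

  gap : Fin m → ℕ
  gap l = cap l ⊓ (card (block l) ∸ cap l)

  basisSize : Fin m → ℕ
  basisSize l = cap l ⊓ card (block l)

  isBasis : Family n
  isBasis = countFamily (λ l k → k ≡ᵇ basisSize l)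

  isBasis⇒full : ∀ X → T (isBasis X) → ∀ l → countIn X l ≡ basisSize l
  isBasis⇒full X B l =
    trans (sym (card-∩-block X l)) (≡ᵇ⇒≡ _ _ (≡true⇒T (allᵇ⁻ (allFin m) (T⇒≡true B) l (∈ₚ.∈-allFin l))))

  full⇒isBasis : ∀ X → (∀ l → countIn X l ≡ basisSize l) → T (isBasis X)
  full⇒isBasis X full = ≡true⇒T (allᵇ⁺ (allFin m) λ l _ →
    T⇒≡true (≡⇒≡ᵇ _ _ (trans (card-∩-block X l) (full l))))

  indep⇒≤basisSize : ∀ X → indep X ≡ true → ∀ l → countIn X l ≤ basisSize l
  indep⇒≤basisSize X IX l = ⊓-glb (indep⇒≤cap X IX l) (countIn-≤-block X l)

  full⇒maximal : ∀ X → (∀ l → countIn X l ≡ basisSize l) → ∀ Y → X ⊆ Y → indep Y ≡ true → Y ⊆ X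
  full⇒maximal X full Y X⊆Y IY y Y∋y with vlookup X y in X∋?y
  ... | true  = tt
  ... | false = <⇒≱ X<Y (subst (countIn Y l ≤_) (sym (full l)) (indep⇒≤basisSize Y IY l))
    where
    l = blk y
    X<Y : countIn X l < countIn Y l
    X<Y = count-< (λ x t → let (X∋x , x∈l) = T-∧⁻ t in T-∧⁺ (X⊆Y x X∋x) x∈l) y
      (T-∧⁺ Y∋y (≡true⇒T (≟-refl l))) (λ t → subst T X∋?y (proj₁ (T-∧⁻ t)))

  ∃-free : ∀ X l → countIn X l < card (block l) → ∃ λ y → blk y ≡ l × vlookup X y ≡ false
  ∃-free X l X<b with Finₚ.any? (λ y → Boolₚ.T? (inBlock y l ∧ not (vlookup X y)))
  ... | yes (y , free) = y , ≟⇒≡ (proj₁ (T-∧⁻ free))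
                            , ¬T⇒≡false (λ X∋y → subst (T ∘ not) (T⇒≡true X∋y) (proj₂ (T-∧⁻ free)))
  ... | no noFree = ⊥-elim (<⇒≱ X<b (subst (_≤ countIn X l) (sym (card-block l)) (count-mono covered)))
    where
    covered : ∀ x → T (inBlock x l) → T (vlookup X x ∧ inBlock x l)
    covered x x∈l with vlookup X x in X∋?x
    ... | true  = x∈l
    ... | false = ⊥-elim (noFree (x , T-∧⁺ x∈l (subst (T ∘ not) (sym X∋?x) tt)))

  insert-indep : ∀ X y → indep X ≡ true → vlookup X y ≡ false → countIn X (blk y) < cap (blk y) →
    indep (X [ y ]≔ true) ≡ true
  insert-indep X y IX X∌y room = ≤cap⇒indep (X [ y ]≔ true) λ l →
    subst (_≤ cap l) (sym (countIn-insert X y l X∌y)) (grows l)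
    where
    grows : ∀ l → countIn X l + bit (inBlock y l) ≤ cap l
    grows l with blk y ≟F l
    ... | yes refl = subst (_≤ cap l) (+-comm 1 _) room
    ... | no _     = subst (_≤ cap l) (sym (+-identityʳ _)) (indep⇒≤cap X IX l)

  maximal⇒full : ∀ X → indep X ≡ true → (∀ Y → X ⊆ Y → indep Y ≡ true → Y ⊆ X) →
    ∀ l → countIn X l ≡ basisSize l
  maximal⇒full X IX maximal l with countIn X l ≟ basisSize l
  ... | yes full = full
  ... | no ¬full = ⊥-elim (roomLeft (≤∧≢⇒< (indep⇒≤basisSize X IX l) ¬full))
    where
    roomLeft : countIn X l < basisSize l → ⊥
    roomLeft X<b with ∃-free X l (<-≤-trans X<b (m⊓n≤n _ _))
    ... | y , refl , X∌y = subst T X∌y (maximal (X [ y ]≔ true) (⊆-insert X y)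
      (insert-indep X y IX X∌y (<-≤-trans X<b (m⊓n≤m _ _))) y (∈-insert X y))

  bases≗isBasis : ∀ X → bases indep X ≡ isBasis X
  bases≗isBasis X = T-injective
    (λ B → full⇒isBasis X (maximal⇒full X (T⇒≡true (proj₁ (T-∧⁻ B))) (bases⇒maximal indep X B)))
    (λ B → maximal⇒bases indep X (≤cap⇒indep X (λ l → subst (_≤ cap l) (sym (isBasis⇒full X B l)) (m⊓n≤m _ _)))
                                 (full⇒maximal X (isBasis⇒full X B)))

-- Levels of a count family along a block-sorted order

Before : ∀ {n} → Permutation′ n → ℕ → Subset n → Set
Before σ p X = ∀ x → X ∋ x → position σ x < p

From : ∀ {n} → Permutation′ n → ℕ → Subset n → Set
From σ p Z = ∀ x → Z ∋ x → p ≤ position σ x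

Before-From-disjoint : ∀ {n} (σ : Permutation′ n) p X Z → Before σ p X → From σ p Z → ∀ x → X ∋ x → ¬ Z ∋ x
Before-From-disjoint σ p X Z X<p p≤Z x X∋x Z∋x = <⇒≱ (X<p x X∋x) (p≤Z x Z∋x)

order≡tabulate : ∀ {n} (σ : Permutation′ n) → order σ ≡ tabulate (σ ⟨$⟩ʳ_)
order≡tabulate σ = Listₚ.map-tabulate id (σ ⟨$⟩ʳ_)

∈-drop-order : ∀ {n} (σ : Permutation′ n) q x → x ∈ drop q (order σ) → q ≤ position σ x
∈-drop-order σ q x x∈ with ∈-drop-tabulate (σ ⟨$⟩ʳ_) q x (subst (λ es → x ∈ drop q es) (order≡tabulate σ) x∈)
... | p , q≤p , refl = subst (λ y → q ≤ toℕ y) (sym (inverseˡ σ)) q≤p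

supported⇒From : ∀ {n} (σ : Permutation′ n) q Z → SupportedIn (drop q (order σ)) Z → From σ q Z
supported⇒From σ q Z supp x Z∋x = ∈-drop-order σ q x (supp x Z∋x)

prefix⇒Before : ∀ {n} (σ : Permutation′ n) p X → T (X ⊆ᵇ prefix σ p) → Before σ p X
prefix⇒Before σ p X X⊆ x X∋x =
  <ᵇ⇒< _ _ (subst T (Vecₚ.lookup∘tabulate (λ y → position σ y <ᵇ p) x) (⊆ᵇ⇒⊆ X (prefix σ p) X⊆ x X∋x))

module Levels {n : ℕ} (M : PartitionMatroid n) (σ : Permutation′ n)
  (sorted : BlockSorted (PartitionMatroid.blk M) σ) (φ : Fin (PartitionMatroid.m M) → ℕ → Bool) where
  open Blocks M

  S : Family n
  S = countFamily φ

  module AtLevel (i : Fin n) where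

    e : Fin n
    e = σ ⟨$⟩ʳ i

    j : Fin m
    j = blk e

    depth : ℕ
    depth = toℕ i

    position-e : position σ e ≡ depth
    position-e = cong toℕ (inverseˡ σ)

    SplitsAt : ℕ → Set
    SplitsAt p = (∀ x → toℕ (blk x) < toℕ j → position σ x < p)
               × (∀ x → toℕ j < toℕ (blk x) → p ≤ position σ x)

    splitsAt-depth : SplitsAt depth
    splitsAt-depth = (λ x b< → subst (position σ x <_) position-e (sorted x e b<))
                   , (λ x b> → <⇒≤ (subst (_< position σ x) position-e (sorted e x b>)))

    splitsAt-suc-depth : SplitsAt (suc depth)
    splitsAt-suc-depth = (λ x b< → m<n⇒m<1+n (proj₁ splitsAt-depth x b<))
                       , (λ x b> → subst (_< position σ x) position-e (sorted e x b>))

    From⇒earlier-empty : ∀ {p} Z l → SplitsAt p → From σ p Z → toℕ l < toℕ j → countIn Z l ≡ 0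
    From⇒earlier-empty Z l splits p≤Z l<j = count-≡0 _ λ x → ¬T⇒≡false λ t →
      let (Z∋x , x∈l) = T-∧⁻ t in
      <⇒≱ (proj₁ splits x (subst (λ k → toℕ k < toℕ j) (sym (≟⇒≡ x∈l)) l<j)) (p≤Z x Z∋x)

    Before⇒later-empty : ∀ {p} X l → SplitsAt p → Before σ p X → toℕ j < toℕ l → countIn X l ≡ 0
    Before⇒later-empty X l splits X<p j<l = count-≡0 _ λ x → ¬T⇒≡false λ t →
      let (X∋x , x∈l) = T-∧⁻ t in
      <⇒≱ (X<p x X∋x) (proj₂ splits x (subst (λ k → toℕ j < toℕ k) (sym (≟⇒≡ x∈l)) j<l))

    Settled : Subset n → Set
    Settled X = ∀ l → toℕ l < toℕ j → φ l (countIn X l) ≡ true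

    residualAt : ℕ → Subset n → Fin m → Bool
    residualAt s Z l with <-cmp (toℕ l) (toℕ j)
    ... | tri< _ _ _ = true
    ... | tri≈ _ _ _ = φ l (s + countIn Z l)
    ... | tri> _ _ _ = φ l (countIn Z l)

    residual : ℕ → Subset n → Bool
    residual s Z = allᵇ (residualAt s Z) (allFin m)

    S-∪-residual : ∀ {p} X Z → SplitsAt p → Before σ p X → From σ p Z → Settled X →
      S (X ∪ Z) ≡ residual (countIn X j) Z
    S-∪-residual {p} X Z splits X<p p≤Z settled = allᵇ-cong (allFin m) λ l _ →
      trans (cong (φ l) (trans (card-∩-block (X ∪ Z) l) (countIn-∪ X Z l (Before-From-disjoint σ p X Z X<p p≤Z))))
        (atBlock l)
      where
      atBlock : ∀ l → φ l (countIn X l + countIn Z l) ≡ residualAt (countIn X j) Z l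
      atBlock l with <-cmp (toℕ l) (toℕ j)
      ... | tri< l<j _ _
        rewrite From⇒earlier-empty Z l splits p≤Z l<j | +-identityʳ (countIn X l) = settled l l<j
      ... | tri> _ _ j<l rewrite Before⇒later-empty X l splits X<p j<l = refl
      ... | tri≈ _ l≡j _ rewrite Finₚ.toℕ-injective l≡j = refl

    residualAt-j : ∀ s Z → residualAt s Z j ≡ φ j (s + countIn Z j)
    residualAt-j s Z with <-cmp (toℕ j) (toℕ j)
    ... | tri< j<j _ _ = ⊥-elim (<-irrefl refl j<j)
    ... | tri≈ _ _ _   = refl
    ... | tri> _ _ j>j = ⊥-elim (<-irrefl refl j>j)

    Agree : ℕ → ℕ → ℕ → Set
    Agree R s s′ = ∀ z → z ≤ R → φ j (s + z) ≡ φ j (s′ + z)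

    residual-cong : ∀ s s′ Z R → Agree R s s′ → countIn Z j ≤ R → residual s Z ≡ residual s′ Z
    residual-cong s s′ Z R agree Z≤R = allᵇ-cong (allFin m) λ l _ → atBlock l
      where
      atBlock : ∀ l → residualAt s Z l ≡ residualAt s′ Z l
      atBlock l with <-cmp (toℕ l) (toℕ j)
      ... | tri< _ _ _   = refl
      ... | tri> _ _ _   = refl
      ... | tri≈ _ l≡j _ rewrite Finₚ.toℕ-injective l≡j = agree (countIn Z j) Z≤R

    residual-false : ∀ s Z → φ j (s + countIn Z j) ≡ false → residual s Z ≡ false
    residual-false s Z φ≡false = allᵇ-false⁺ (allFin m) j (∈ₚ.∈-allFin j) (trans (residualAt-j s Z) φ≡false)

    #before : ℕ
    #before = count (λ x → inBlock x j ∧ (position σ x <ᵇ depth))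

    #from : ℕ → ℕ
    #from p = count (λ x → inBlock x j ∧ not (position σ x <ᵇ p))

    #rest : ℕ
    #rest = #from depth

    card-block-j : card (block j) ≡ #before + #rest
    card-block-j = trans (card-block j) (count-split (λ x → inBlock x j) (λ x → position σ x <ᵇ depth))

    #from-suc-depth : #from (suc depth) < #rest
    #from-suc-depth = count-< from-suc⇒from e
      (T-∧⁺ (≡true⇒T (≟-refl j)) (≥⇒≮ᵇ (≤-reflexive (sym position-e))))
      (λ t → <⇒≱ (n<1+n depth) (subst (suc depth ≤_) position-e (≮ᵇ⇒≥ (proj₂ (T-∧⁻ t)))))
      where
      from-suc⇒from : ∀ x → T (inBlock x j ∧ not (position σ x <ᵇ suc depth)) →
                            T (inBlock x j ∧ not (position σ x <ᵇ depth))
      from-suc⇒from x t = let (x∈j , x≮) = T-∧⁻ t in T-∧⁺ x∈j (≥⇒≮ᵇ (≤-trans (n≤1+n depth) (≮ᵇ⇒≥ x≮)))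

    countIn-Before : ∀ X → Before σ depth X → countIn X j ≤ #before
    countIn-Before X X<d = count-mono λ x t →
      let (X∋x , x∈j) = T-∧⁻ t in T-∧⁺ x∈j (<⇒<ᵇ (X<d x X∋x))

    countIn-From : ∀ p Z → From σ p Z → countIn Z j ≤ #from p
    countIn-From p Z p≤Z = count-mono λ x t →
      let (Z∋x , x∈j) = T-∧⁻ t in T-∧⁺ x∈j (≥⇒≮ᵇ (p≤Z x Z∋x))

    X∌e : ∀ X → Before σ depth X → vlookup X e ≡ false
    X∌e X X<d = ¬T⇒≡false (λ X∋e → <-irrefl position-e (X<d e X∋e))

    insert-e-Before : ∀ X → Before σ depth X → Before σ (suc depth) (X [ e ]≔ true)
    insert-e-Before X X<d x X′∋x with x ≟F e
    ... | yes refl = subst (_< suc depth) (sym position-e) (n<1+n depth)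
    ... | no x≢e   = m<n⇒m<1+n (X<d x (subst T (Vecₚ.lookup∘update′ x≢e X true) X′∋x))

    Before-suc : ∀ X → Before σ depth X → Before σ (suc depth) X
    Before-suc X X<d x X∋x = m<n⇒m<1+n (X<d x X∋x)

    countIn-insert-e-j : ∀ X → Before σ depth X → countIn (X [ e ]≔ true) j ≡ suc (countIn X j)
    countIn-insert-e-j X X<d rewrite countIn-insert X e j (X∌e X X<d) | ≟-refl j = +-comm (countIn X j) 1

    insert-e-Settled : ∀ X → Before σ depth X → Settled X → Settled (X [ e ]≔ true)
    insert-e-Settled X X<d settled l l<j rewrite countIn-insert X e l (X∌e X X<d) with blk e ≟F l
    ... | yes refl = ⊥-elim (<-irrefl refl l<j)
    ... | no _     rewrite +-identityʳ (countIn X l) = settled l l<j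

    labels labels′ : List (Fin n)
    labels  = drop depth (order σ)
    labels′ = drop (suc depth) (order σ)

    labels≡ : labels ≡ e ∷ labels′
    labels≡ rewrite order≡tabulate σ = drop-tabulate (σ ⟨$⟩ʳ_) i

    e∉labels′ : ¬ e ∈ labels′
    e∉labels′ e∈ = 1+n≰n (subst (suc depth ≤_) position-e (∈-drop-order σ (suc depth) e e∈))

    nodeAt : Kind → Subset n → DD n
    nodeAt κ X = red κ S labels X

    nodeAt-unfold : ∀ κ X → nodeAt κ X ≡ mk κ e (red κ S labels′ X) (red κ S labels′ (X [ e ]≔ true))
    nodeAt-unfold κ X = cong (λ es → red κ S es X) labels≡

    unsettled⇒⊥N : ∀ κ X → Before σ depth X → ∀ l → toℕ l < toℕ j → φ l (countIn X l) ≡ false →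
      nodeAt κ X ≡ ⊥N
    unsettled⇒⊥N κ X X<d l l<j φl≡false = red-≡⊥N κ S labels X λ Z supp →
      let d≤Z = supported⇒From σ depth Z supp in
      allᵇ-false⁺ (allFin m) l (∈ₚ.∈-allFin l) (begin
        φ l (card ((X ∪ Z) ∩ block l))     ≡⟨ cong (φ l) (card-∩-block (X ∪ Z) l) ⟩
        φ l (countIn (X ∪ Z) l)
          ≡⟨ cong (φ l) (countIn-∪ X Z l (Before-From-disjoint σ depth X Z X<d d≤Z)) ⟩
        φ l (countIn X l + countIn Z l)
          ≡⟨ cong (λ k → φ l (countIn X l + k)) (From⇒earlier-empty Z l splitsAt-depth d≤Z l<j) ⟩
        φ l (countIn X l + 0)              ≡⟨ cong (φ l) (+-identityʳ (countIn X l)) ⟩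
        φ l (countIn X l)                  ≡⟨ φl≡false ⟩
        false                              ∎)
      where open ≡-Reasoning

    labelled⇒Settled : ∀ κ X → Before σ depth X → T (labelledᵇ e (nodeAt κ X)) → Settled X
    labelled⇒Settled κ X X<d labelled l l<j with φ l (countIn X l) in φl
    ... | true  = refl
    ... | false = ⊥-elim (subst T (cong (labelledᵇ e) (unsettled⇒⊥N κ X X<d l l<j φl)) labelled)

    Dead : ℕ → Set
    Dead s = ∀ z → z ≤ #rest → φ j (s + z) ≡ false

    dead⇒⊥N : ∀ κ X → Before σ depth X → Settled X → Dead (countIn X j) → nodeAt κ X ≡ ⊥N
    dead⇒⊥N κ X X<d settled dead = red-≡⊥N κ S labels X λ Z supp →
      let d≤Z = supported⇒From σ depth Z supp in
      trans (S-∪-residual X Z splitsAt-depth X<d d≤Z settled)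
            (residual-false (countIn X j) Z (dead (countIn Z j) (countIn-From depth Z d≤Z)))

    labelled⇒¬Dead : ∀ κ X → Before σ depth X → T (labelledᵇ e (nodeAt κ X)) → ¬ Dead (countIn X j)
    labelled⇒¬Dead κ X X<d labelled dead = subst T
      (cong (labelledᵇ e) (dead⇒⊥N κ X X<d (labelled⇒Settled κ X X<d labelled) dead)) labelled

    nodeAt-cong : ∀ κ X X′ → Before σ depth X → Before σ depth X′ → Settled X → Settled X′ →
      Agree #rest (countIn X j) (countIn X′ j) → nodeAt κ X ≡ nodeAt κ X′
    nodeAt-cong κ X X′ X<d X′<d settled settled′ agree = red-cong κ S labels X X′ λ Z supp →
      let d≤Z = supported⇒From σ depth Z supp in begin
        S (X ∪ Z)                    ≡⟨ S-∪-residual X Z splitsAt-depth X<d d≤Z settled ⟩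
        residual (countIn X j) Z     ≡⟨ residual-cong _ _ Z #rest agree (countIn-From depth Z d≤Z) ⟩
        residual (countIn X′ j) Z    ≡⟨ S-∪-residual X′ Z splitsAt-depth X′<d d≤Z settled′ ⟨
        S (X′ ∪ Z)                   ∎
      where open ≡-Reasoning

    -- the deletion rule of κ removes the node at every X with Skips κ (countIn X j)
    Skips : Kind → ℕ → Set
    Skips BDD s = ∀ z → z < #rest → φ j (s + z) ≡ φ j (suc s + z)
    Skips ZDD s = ∀ z → z < #rest → φ j (suc s + z) ≡ false

    module _ (X : Subset n) (X<d : Before σ depth X) (settled : Settled X) where

      S-∪-insert-e : ∀ Z → From σ (suc depth) Z → S ((X [ e ]≔ true) ∪ Z) ≡ residual (suc (countIn X j)) Z
      S-∪-insert-e Z d<Z = trans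
        (S-∪-residual (X [ e ]≔ true) Z splitsAt-suc-depth
          (insert-e-Before X X<d) d<Z (insert-e-Settled X X<d settled))
        (cong (λ s → residual s Z) (countIn-insert-e-j X X<d))

      countIn-From-suc : ∀ Z z → From σ (suc depth) Z → z ≤ countIn Z j → z < #rest
      countIn-From-suc Z z d<Z z≤ = <-≤-trans (s≤s (≤-trans z≤ (countIn-From (suc depth) Z d<Z))) #from-suc-depth

      low high : Kind → DD n
      low  κ = red κ S labels′ X
      high κ = red κ S labels′ (X [ e ]≔ true)

      skips⇒unlabelled : ∀ κ → Skips κ (countIn X j) → labelledᵇ e (nodeAt κ X) ≡ false
      skips⇒unlabelled BDD skips = begin
        labelledᵇ e (nodeAt BDD X)                  ≡⟨ cong (labelledᵇ e) (nodeAt-unfold BDD X) ⟩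
        labelledᵇ e (mk BDD e (low BDD) (high BDD)) ≡⟨ cong (λ h → labelledᵇ e (mk BDD e (low BDD) h)) low≡high ⟨
        labelledᵇ e (mk BDD e (low BDD) (low BDD))  ≡⟨ cong (labelledᵇ e) (mk-BDD-≡ e (low BDD)) ⟩
        labelledᵇ e (low BDD)                       ≡⟨ red-unlabelled BDD S labels′ X e e∉labels′ ⟩
        false                                       ∎
        where
        open ≡-Reasoning
        low≡high : low BDD ≡ high BDD
        low≡high = red-cong BDD S labels′ X (X [ e ]≔ true) λ Z supp →
          let d<Z = supported⇒From σ (suc depth) Z supp in begin
          S (X ∪ Z)                        ≡⟨ S-∪-residual X Z splitsAt-suc-depth (Before-suc X X<d) d<Z settled ⟩
          residual (countIn X j) Z         ≡⟨ residual-cong _ _ Z (countIn Z j)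
                                                (λ z z≤ → skips z (countIn-From-suc Z z d<Z z≤)) ≤-refl ⟩
          residual (suc (countIn X j)) Z   ≡⟨ S-∪-insert-e Z d<Z ⟨
          S ((X [ e ]≔ true) ∪ Z)          ∎
      skips⇒unlabelled ZDD skips = begin
        labelledᵇ e (nodeAt ZDD X)                  ≡⟨ cong (labelledᵇ e) (nodeAt-unfold ZDD X) ⟩
        labelledᵇ e (mk ZDD e (low ZDD) (high ZDD)) ≡⟨ cong (λ h → labelledᵇ e (mk ZDD e (low ZDD) h)) high≡⊥N ⟩
        labelledᵇ e (mk ZDD e (low ZDD) ⊥N)         ≡⟨ cong (labelledᵇ e) (mk-ZDD-⊥N e (low ZDD)) ⟩
        labelledᵇ e (low ZDD)                       ≡⟨ red-unlabelled ZDD S labels′ X e e∉labels′ ⟩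
        false                                       ∎
        where
        open ≡-Reasoning
        high≡⊥N : high ZDD ≡ ⊥N
        high≡⊥N = red-≡⊥N ZDD S labels′ (X [ e ]≔ true) λ Z supp →
          let d<Z = supported⇒From σ (suc depth) Z supp in
          trans (S-∪-insert-e Z d<Z) (residual-false _ Z (skips (countIn Z j) (countIn-From-suc Z _ d<Z ≤-refl)))

    labelled⇒¬Skips : ∀ κ X → Before σ depth X → T (labelledᵇ e (nodeAt κ X)) → ¬ Skips κ (countIn X j)
    labelled⇒¬Skips κ X X<d labelled skips =
      subst T (skips⇒unlabelled X X<d (labelled⇒Settled κ X X<d labelled) κ skips) labelled

    levelWidth-≤ : ∀ κ (key : ℕ → ℕ) lo hi →
      (∀ s s′ → s ≤ #before → s′ ≤ #before → key s ≡ key s′ → Agree #rest s s′) →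
      (∀ s → s ≤ #before → ¬ Dead s → ¬ Skips κ s → lo ≤ key s × key s < hi) →
      levelWidth κ S σ i ≤ hi ∸ lo
    levelWidth-≤ κ key lo hi key-determines key-range =
      distinctNodes-≤ (nodeAt κ) (λ X → key (countIn X j)) (labelledᵇ e) lo hi prefixSubsets inRange sameKey
      where
      prefixSubsets : List (Subset n)
      prefixSubsets = filterᵇ (λ X → X ⊆ᵇ prefix σ depth) (allSubsets n)

      member⇒Before : ∀ X → X ∈ prefixSubsets → Before σ depth X
      member⇒Before X X∈ = prefix⇒Before σ depth X
        (proj₂ (∈ₚ.∈-filter⁻ (λ X → Boolₚ.T? (X ⊆ᵇ prefix σ depth)) {xs = allSubsets n} X∈))

      inRange : ∀ X → X ∈ prefixSubsets → T (labelledᵇ e (nodeAt κ X)) →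
        lo ≤ key (countIn X j) × key (countIn X j) < hi
      inRange X X∈ labelled = let X<d = member⇒Before X X∈ in
        key-range (countIn X j) (countIn-Before X X<d)
          (labelled⇒¬Dead κ X X<d labelled) (labelled⇒¬Skips κ X X<d labelled)

      sameKey : ∀ X X′ → X ∈ prefixSubsets → X′ ∈ prefixSubsets →
        T (labelledᵇ e (nodeAt κ X)) → T (labelledᵇ e (nodeAt κ X′)) →
        key (countIn X j) ≡ key (countIn X′ j) → nodeAt κ X ≡ nodeAt κ X′
      sameKey X X′ X∈ X′∈ labelled labelled′ key≡ =
        let X<d = member⇒Before X X∈ ; X′<d = member⇒Before X′ X′∈ in
        nodeAt-cong κ X X′ X<d X′<d (labelled⇒Settled κ X X<d labelled) (labelled⇒Settled κ X′ X′<d labelled′)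
          (key-determines _ _ (countIn-Before X X<d) (countIn-Before X′ X′<d) key≡)

-- Level widths of a partition matroid

m∸[n∸o]≤[m+o]∸n : ∀ m n o → m ∸ (n ∸ o) ≤ (m + o) ∸ n
m∸[n∸o]≤[m+o]∸n m n       zero    = ≤-reflexive (cong (_∸ n) (sym (+-identityʳ m)))
m∸[n∸o]≤[m+o]∸n m zero    (suc o) = m≤m+n m (suc o)
m∸[n∸o]≤[m+o]∸n m (suc n) (suc o) =
  subst (λ k → m ∸ (n ∸ o) ≤ k ∸ suc n) (sym (+-suc m o)) (m∸[n∸o]≤[m+o]∸n m n o)

[m⊔n]∸n≡m∸n : ∀ m n → (m ⊔ n) ∸ n ≡ m ∸ n
[m⊔n]∸n≡m∸n zero    n       = trans (n∸n≡0 n) (sym (0∸n≡0 n))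
[m⊔n]∸n≡m∸n (suc m) zero    = refl
[m⊔n]∸n≡m∸n (suc m) (suc n) = [m⊔n]∸n≡m∸n m n

m>0∧n>0⇒m∸n<m : ∀ {m n} → 0 < m → 0 < n → m ∸ n < m
m>0∧n>0⇒m∸n<m {suc m} {suc n} _ _ = s≤s (m∸n≤m m n)

indepBDD-keys≤ : ∀ t c r → suc (t ⊓ c) ∸ (suc c ∸ r) ≤ suc (c ⊓ ((t + r) ∸ c))
indepBDD-keys≤ t c r = ⊓-glb
  (≤-trans (m∸n≤m (suc (t ⊓ c)) (suc c ∸ r)) (s≤s (m⊓n≤n t c)))
  (≤-trans (∸-monoˡ-≤ (suc c ∸ r) (s≤s (m⊓n≤m t c))) (≤-trans (m∸[n∸o]≤[m+o]∸n (suc t) (suc c) r) (n≤1+n _)))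

indepZDD-keys≤ : ∀ t c r → (c ⊓ suc (t ⊔ (c ∸ r))) ∸ (c ∸ r) ≤ suc (c ⊓ ((t + r) ∸ c))
indepZDD-keys≤ t c r = ⊓-glb
  (≤-trans (m∸n≤m _ (c ∸ r)) (≤-trans (m⊓n≤m c _) (n≤1+n c)))
  (begin
    (c ⊓ suc (t ⊔ (c ∸ r))) ∸ (c ∸ r)  ≤⟨ ∸-monoˡ-≤ (c ∸ r) (m⊓n≤n c _) ⟩
    suc (t ⊔ (c ∸ r)) ∸ (c ∸ r)        ≡⟨ +-∸-assoc 1 (m≤n⊔m t (c ∸ r)) ⟩
    suc ((t ⊔ (c ∸ r)) ∸ (c ∸ r))      ≡⟨ cong suc ([m⊔n]∸n≡m∸n t (c ∸ r)) ⟩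
    suc (t ∸ (c ∸ r))                  ≤⟨ s≤s (m∸[n∸o]≤[m+o]∸n t c r) ⟩
    suc ((t + r) ∸ c)                  ∎)
  where open ≤-Reasoning

basis-keys≤ : ∀ t c r → suc (t ⊓ (c ⊓ (t + r))) ∸ ((c ⊓ (t + r)) ∸ r) ≤ suc (c ⊓ ((t + r) ∸ c))
basis-keys≤ t c r = ⊓-glb
  (≤-trans (m∸n≤m _ (d ∸ r)) (s≤s (≤-trans (m⊓n≤n t d) (m⊓n≤m c (t + r)))))
  toRest
  where
  d = c ⊓ (t + r)
  toRest : suc (t ⊓ d) ∸ (d ∸ r) ≤ suc ((t + r) ∸ c)
  toRest with ≤-total c (t + r)
  ... | inj₁ c≤b rewrite m≤n⇒m⊓n≡m c≤b =
    ≤-trans (∸-monoˡ-≤ (c ∸ r) (s≤s (m⊓n≤m t c)))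
      (≤-trans (m∸[n∸o]≤[m+o]∸n (suc t) c r) (≤-reflexive (+-∸-assoc 1 c≤b)))
  ... | inj₂ b≤c rewrite m≥n⇒m⊓n≡n b≤c | m≤n⇒m⊓n≡m (m≤m+n t r) | m+n∸n≡m t r | m+n∸n≡m 1 t = s≤s z≤n

module PartitionWidths {n : ℕ} (M : PartitionMatroid n) (σ : Permutation′ n)
  (sorted : BlockSorted (PartitionMatroid.blk M) σ) (i : Fin n) where
  open Blocks M

  module IndepLevel = Levels.AtLevel M σ sorted (λ l k → k ≤ᵇ cap l) i
  module BasisLevel = Levels.AtLevel M σ sorted (λ l k → k ≡ᵇ basisSize l) i
  open IndepLevel using (j; #before; #rest; #from-suc-depth; card-block-j)

  ≤ᵇ-true : ∀ {a b} → a ≤ b → (a ≤ᵇ b) ≡ true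
  ≤ᵇ-true a≤b = T⇒≡true (≤⇒≤ᵇ a≤b)

  ≤ᵇ-false : ∀ {a b} → b < a → (a ≤ᵇ b) ≡ false
  ≤ᵇ-false b<a = ¬T⇒≡false (λ a≤ᵇb → <⇒≱ b<a (≤ᵇ⇒≤ _ _ a≤ᵇb))

  c : ℕ
  c = cap j

  widthBound : ℕ
  widthBound = suc (gap j)

  ≤widthBound : ∀ {k} → k ≤ suc (c ⊓ ((#before + #rest) ∸ c)) → k ≤ widthBound
  ≤widthBound {k} = subst (λ b → k ≤ suc (c ⊓ (b ∸ c))) (sym card-block-j)

  -- Below c ∸ #rest all counts behave alike: every completion stays within capacity.
  indepKey : ℕ → ℕ
  indepKey s = s ⊔ (c ∸ #rest)

  indepKey-agrees : ∀ s z → z ≤ #rest → (s + z ≤ᵇ c) ≡ (indepKey s + z ≤ᵇ c)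
  indepKey-agrees s z z≤r with c ∸ #rest ≤? s
  ... | yes c∸r≤s rewrite m≥n⇒m⊔n≡m c∸r≤s = refl
  ... | no c∸r≰s = trans (≤ᵇ-true (fits s (<⇒≤ s<c∸r)))
                         (sym (≤ᵇ-true (fits (indepKey s) (≤-reflexive (m≤n⇒m⊔n≡n (<⇒≤ s<c∸r))))))
    where
    s<c∸r : s < c ∸ #rest
    s<c∸r = ≰⇒> c∸r≰s
    r≤c : #rest ≤ c
    r≤c = ≮⇒≥ λ c<r → <⇒≱ s<c∸r (subst (_≤ s) (sym (m≤n⇒m∸n≡0 (<⇒≤ c<r))) z≤n)
    fits : ∀ k → k ≤ c ∸ #rest → k + z ≤ c
    fits k k≤ = ≤-trans (+-mono-≤ k≤ z≤r) (≤-reflexive (m∸n+n≡m r≤c))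

  indepKey-determines : ∀ s s′ → s ≤ #before → s′ ≤ #before → indepKey s ≡ indepKey s′ →
    IndepLevel.Agree #rest s s′
  indepKey-determines s s′ _ _ key≡ z z≤r =
    trans (indepKey-agrees s z z≤r) (trans (cong (λ k → k + z ≤ᵇ c) key≡) (sym (indepKey-agrees s′ z z≤r)))

  alive⇒≤cap : ∀ s → ¬ IndepLevel.Dead s → s ≤ c
  alive⇒≤cap s alive = ≮⇒≥ λ c<s → alive (λ z _ → ≤ᵇ-false (<-≤-trans c<s (m≤m+n s z)))

  #rest>0 : 0 < #rest
  #rest>0 = <-≤-trans (s≤s z≤n) #from-suc-depth

  indepBDD-width : levelWidth BDD indep σ i ≤ widthBound
  indepBDD-width = ≤-trans
    (IndepLevel.levelWidth-≤ BDD indepKey (suc c ∸ #rest) (suc (#before ⊓ c)) indepKey-determines range)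
    (≤widthBound (indepBDD-keys≤ #before c #rest))
    where
    range : ∀ s → s ≤ #before → ¬ IndepLevel.Dead s → ¬ IndepLevel.Skips BDD s →
      suc c ∸ #rest ≤ indepKey s × indepKey s < suc (#before ⊓ c)
    range s s≤t alive branches = lo , hi
      where
      c<s+r : c < s + #rest
      c<s+r = ≰⇒> λ s+r≤c → branches λ z z<r →
        trans (≤ᵇ-true (≤-trans (+-monoʳ-≤ s (<⇒≤ z<r)) s+r≤c))
              (sym (≤ᵇ-true (≤-trans (≤-reflexive (sym (+-suc s z))) (≤-trans (+-monoʳ-≤ s z<r) s+r≤c))))
      key≡s : indepKey s ≡ s
      key≡s = m≥n⇒m⊔n≡m (≤-trans (∸-monoˡ-≤ #rest (<⇒≤ c<s+r)) (≤-reflexive (m+n∸n≡m s #rest)))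
      lo : suc c ∸ #rest ≤ indepKey s
      lo rewrite key≡s = ≤-trans (∸-monoˡ-≤ #rest c<s+r) (≤-reflexive (m+n∸n≡m s #rest))
      hi : indepKey s < suc (#before ⊓ c)
      hi rewrite key≡s = s≤s (⊓-glb s≤t (alive⇒≤cap s alive))

  indepZDD-width : levelWidth ZDD indep σ i ≤ widthBound
  indepZDD-width = ≤-trans
    (IndepLevel.levelWidth-≤ ZDD indepKey (c ∸ #rest) (c ⊓ suc (#before ⊔ (c ∸ #rest))) indepKey-determines range)
    (≤widthBound (indepZDD-keys≤ #before c #rest))
    where
    range : ∀ s → s ≤ #before → ¬ IndepLevel.Dead s → ¬ IndepLevel.Skips ZDD s →
      c ∸ #rest ≤ indepKey s × indepKey s < c ⊓ suc (#before ⊔ (c ∸ #rest))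
    range s s≤t _ branches = m≤n⊔m s (c ∸ #rest) , ⊓-glb key<c (s≤s (⊔-monoˡ-≤ (c ∸ #rest) s≤t))
      where
      s<c : s < c
      s<c = ≰⇒> λ c≤s → branches λ z _ → ≤ᵇ-false (s≤s (≤-trans c≤s (m≤m+n s z)))
      key<c : indepKey s < c
      key<c = ⊔-lub s<c (m>0∧n>0⇒m∸n<m (≤-<-trans z≤n s<c) #rest>0)

  basis-width : ∀ κ → levelWidth κ isBasis σ i ≤ widthBound
  basis-width κ = ≤-trans
    (BasisLevel.levelWidth-≤ κ id (d ∸ #rest) (suc (#before ⊓ d))
      (λ s s′ _ _ s≡s′ z _ → cong (λ k → k + z ≡ᵇ d) s≡s′) range)
    (subst (λ b → suc (#before ⊓ (c ⊓ b)) ∸ ((c ⊓ b) ∸ #rest) ≤ suc (c ⊓ (b ∸ c))) (sym card-block-j)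
      (basis-keys≤ #before c #rest))
    where
    d = basisSize j
    range : ∀ s → s ≤ #before → ¬ BasisLevel.Dead s → ¬ BasisLevel.Skips κ s →
      d ∸ #rest ≤ s × s < suc (#before ⊓ d)
    range s s≤t alive _ = lo , s≤s (⊓-glb s≤t s≤d)
      where
      ≡ᵇ-false : ∀ {a b} → a ≢ b → (a ≡ᵇ b) ≡ false
      ≡ᵇ-false a≢b = ¬T⇒≡false (λ a≡ᵇb → a≢b (≡ᵇ⇒≡ _ _ a≡ᵇb))
      s≤d : s ≤ d
      s≤d = ≮⇒≥ λ d<s → alive λ z _ → ≡ᵇ-false λ s+z≡d → <⇒≱ d<s (≤-trans (m≤m+n s z) (≤-reflexive s+z≡d))
      lo : d ∸ #rest ≤ s
      lo = m≤n+o⇒m∸n≤o d #rest (≮⇒≥ λ r+s<d → alive λ z z≤r → ≡ᵇ-false λ s+z≡d →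
        <⇒≱ r+s<d (≤-trans (≤-reflexive (sym s+z≡d)) (≤-trans (+-monoʳ-≤ s z≤r) (≤-reflexive (+-comm s #rest)))))

-- Rank and connectivity

rank-≥ : ∀ {n} (I : Family n) X Y → Y ⊆ X → I Y ≡ true → card Y ≤ rank I X
rank-≥ {n} I X Y Y⊆X IY = subst (_≤ rank I X) candidate≡
  (≤-maxList _ _ (∈ₚ.∈-map⁺ candidate (∈-allSubsets Y)))
  where
  candidate : Subset n → ℕ
  candidate Z = if (Z ⊆ᵇ X) ∧ I Z then card Z else 0
  candidate≡ : candidate Y ≡ card Y
  candidate≡ rewrite T⇒≡true (⊆⇒⊆ᵇ Y X Y⊆X) | IY = refl

rank-≤ : ∀ {n} (I : Family n) X b → (∀ Y → I Y ≡ true → card Y ≤ b) → rank I X ≤ b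
rank-≤ {n} I X b bounded = maxList-≤ _ b λ k k∈ → candidate≤ k (∈ₚ.∈-map⁻ candidate k∈)
  where
  candidate : Subset n → ℕ
  candidate Z = if (Z ⊆ᵇ X) ∧ I Z then card Z else 0
  candidate≤ : ∀ k → ∃ (λ Y → Y ∈ allSubsets n × k ≡ candidate Y) → k ≤ b
  candidate≤ k (Y , _ , refl) with (Y ⊆ᵇ X) ∧ I Y in ok
  ... | false = z≤n
  ... | true  = bounded Y (T⇒≡true (proj₂ (T-∧⁻ {Y ⊆ᵇ X} (≡true⇒T ok))))

conn-≥ : ∀ {n} (I : Family n) X g → I ∅ ≡ true →
  (∀ Y → I Y ≡ true → card Y + g ≤ rank I X + rank I (complement X)) → g ≤ conn I X
conn-≥ {n} I X g I∅ exchange = m+n≤o⇒m≤o∸n g (≤-trans (+-monoʳ-≤ g rankE≤) (≤-reflexive (m+[n∸m]≡n g≤)))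
  where
  g≤ : g ≤ rank I X + rank I (complement X)
  g≤ = subst (_≤ _) (cong (_+ g) (card-∅ n)) (exchange ∅ I∅)
    where
    card-∅ : ∀ k → card (replicate k false) ≡ 0
    card-∅ zero    = refl
    card-∅ (suc k) = card-∅ k
  rankE≤ : rank I full ≤ rank I X + rank I (complement X) ∸ g
  rankE≤ = rank-≤ I full _ λ Y IY → m+n≤o⇒m≤o∸n (card Y) (exchange Y IY)

-- Pathwidth of a partition matroid

discrete-ivt : ∀ (F : ℕ → ℕ) c N → F 0 ≡ 0 → (∀ p → F (suc p) ≤ suc (F p)) → c ≤ F N →
  ∃ λ p → p ≤ N × F p ≡ c
discrete-ivt F c zero    F0 _    c≤ = 0 , z≤n , trans F0 (sym (n≤0⇒n≡0 (subst (c ≤_) F0 c≤)))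
discrete-ivt F c (suc N) F0 step c≤ with c ≤? F N
... | yes c≤FN = let (p , p≤N , Fp≡c) = discrete-ivt F c N F0 step c≤FN in p , m≤n⇒m≤1+n p≤N , Fp≡c
... | no  c≰FN = suc N , ≤-refl , ≤-antisym (≤-trans (step N) (≰⇒> c≰FN)) c≤

module PathwidthBound {n : ℕ} (M : PartitionMatroid n) where
  open Blocks M

  card-tabulate : ∀ (f : Fin n → Bool) → card (vtabulate f) ≡ count f
  card-tabulate f = trans (card-count (vtabulate f)) (count-cong (Vecₚ.lookup∘tabulate f))

  tabulate-indep : ∀ (f h : Fin n → Bool) l Y → indep Y ≡ true →
    (∀ x → T (f x) → T (inBlock x l) → T (h x)) → count h ≤ cap l →
    (∀ x → T (f x) → ¬ T (inBlock x l) → Y ∋ x) → indep (vtabulate f) ≡ true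
  tabulate-indep f h l Y IY inside h≤c outside = ≤cap⇒indep (vtabulate f) λ l′ →
    subst (_≤ cap l′) (sym (count-cong λ x → cong (_∧ inBlock x l′) (Vecₚ.lookup∘tabulate f x))) (bound l′)
    where
    bound : ∀ l′ → count (λ x → f x ∧ inBlock x l′) ≤ cap l′
    bound l′ with l ≟F l′
    ... | yes refl = ≤-trans (count-mono λ x t → let (fx , x∈l) = T-∧⁻ t in inside x fx x∈l) h≤c
    ... | no l≢l′  = ≤-trans (count-mono λ x t → let (fx , x∈l′) = T-∧⁻ t in
            T-∧⁺ (outside x fx λ x∈l → l≢l′ (trans (sym (≟⇒≡ x∈l)) (≟⇒≡ x∈l′))) x∈l′)
          (indep⇒≤cap Y IY l′)

  module Exchange (X : Subset n) (l : Fin m) (X-full : countIn X l ≡ cap l) (c≤b : cap l ≤ card (block l)) where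

    c b g : ℕ
    c = cap l
    b = card (block l)
    g = gap l

    inL : Fin n → Bool
    inL x = inBlock x l

    X∋? : Fin n → Bool
    X∋? = vlookup X

    #outside : count (λ x → inL x ∧ not (X∋? x)) ≡ b ∸ c
    #outside = trans (sym (m+n∸m≡n c _)) (cong (_∸ c) (sym b≡c+#outside))
      where
      b≡c+#outside : b ≡ c + count (λ x → inL x ∧ not (X∋? x))
      b≡c+#outside = trans (card-block l) (trans (count-split inL X∋?)
        (cong (_+ count (λ x → inL x ∧ not (X∋? x)))
          (trans (count-cong (λ x → Boolₚ.∧-comm (inL x) (X∋? x))) X-full)))

    spare : Σ (Fin n → Bool) (λ w → (∀ x → T (w x) → T (inL x ∧ not (X∋? x))) × count w ≡ g)
    spare = ∃⊆-count≡ _ g (subst (g ≤_) (sym #outside) (m⊓n≤n c (b ∸ c)))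

    w : Fin n → Bool
    w = proj₁ spare

    w⊆ : ∀ x → T (w x) → T (inL x ∧ not (X∋? x))
    w⊆ = proj₁ (proj₂ spare)

    module _ (Y : Subset n) (IY : indep Y ≡ true) where

      offL : Bool → Fin n → Bool
      offL inside x = (vlookup Y x ∧ not (inL x)) ∧ (if inside then X∋? x else not (X∋? x))

      offL-parts : ∀ inside x → T (offL inside x) → Y ∋ x × T (not (inL x))
      offL-parts inside x t = T-∧⁻ {vlookup Y x} (proj₁ (T-∧⁻ {vlookup Y x ∧ not (inL x)} t))

      -- Y₁ ⊆ X is X on block l and Y ∩ X elsewhere; Y₂ ⊆ E ∖ X is w on block l and Y ∖ X elsewhere
      y₁ y₂ : Fin n → Bool
      y₁ x = (X∋? x ∧ inL x) ∨ offL true x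
      y₂ x = w x ∨ offL false x

      card-Y : card Y ≡ countIn Y l + (count (offL true) + count (offL false))
      card-Y = trans (card-count Y) (trans (count-split (vlookup Y) inL)
        (cong (countIn Y l +_) (count-split (λ x → vlookup Y x ∧ not (inL x)) X∋?)))

      count-y₁ : count y₁ ≡ c + count (offL true)
      count-y₁ = trans (count-∨ (λ x → X∋? x ∧ inL x) (offL true) λ x t t′ →
                         T-not⇒¬T (proj₂ (offL-parts true x t′)) (proj₂ (T-∧⁻ {X∋? x} t)))
                       (cong (_+ count (offL true)) X-full)

      count-y₂ : count y₂ ≡ g + count (offL false)
      count-y₂ = trans (count-∨ w (offL false) λ x t t′ →
                         T-not⇒¬T (proj₂ (offL-parts false x t′)) (proj₁ (T-∧⁻ {inL x} (w⊆ x t))))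
                       (cong (_+ count (offL false)) (proj₂ (proj₂ spare)))

      y₁-indep : indep (vtabulate y₁) ≡ true
      y₁-indep = tabulate-indep y₁ (λ x → X∋? x ∧ inL x) l Y IY inside (≤-reflexive X-full) outside
        where
        inside : ∀ x → T (y₁ x) → T (inL x) → T (X∋? x ∧ inL x)
        inside x t x∈l with T-∨⁻ {X∋? x ∧ inL x} t
        ... | inj₁ t₁ = t₁
        ... | inj₂ t₂ = ⊥-elim (T-not⇒¬T (proj₂ (offL-parts true x t₂)) x∈l)
        outside : ∀ x → T (y₁ x) → ¬ T (inL x) → Y ∋ x
        outside x t x∉l with T-∨⁻ {X∋? x ∧ inL x} t
        ... | inj₁ t₁ = ⊥-elim (x∉l (proj₂ (T-∧⁻ {X∋? x} t₁)))
        ... | inj₂ t₂ = proj₁ (offL-parts true x t₂)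

      y₂-indep : indep (vtabulate y₂) ≡ true
      y₂-indep = tabulate-indep y₂ w l Y IY inside
        (≤-trans (≤-reflexive (proj₂ (proj₂ spare))) (m⊓n≤m c _)) outside
        where
        inside : ∀ x → T (y₂ x) → T (inL x) → T (w x)
        inside x t x∈l with T-∨⁻ {w x} t
        ... | inj₁ t₁ = t₁
        ... | inj₂ t₂ = ⊥-elim (T-not⇒¬T (proj₂ (offL-parts false x t₂)) x∈l)
        outside : ∀ x → T (y₂ x) → ¬ T (inL x) → Y ∋ x
        outside x t x∉l with T-∨⁻ {w x} t
        ... | inj₁ t₁ = ⊥-elim (x∉l (proj₁ (T-∧⁻ {inL x} (w⊆ x t₁))))
        ... | inj₂ t₂ = proj₁ (offL-parts false x t₂)

      y₁⊆X : vtabulate y₁ ⊆ X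
      y₁⊆X x t with T-∨⁻ {X∋? x ∧ inL x} (subst T (Vecₚ.lookup∘tabulate y₁ x) t)
      ... | inj₁ t₁ = proj₁ (T-∧⁻ {X∋? x} t₁)
      ... | inj₂ t₂ = proj₂ (T-∧⁻ {vlookup Y x ∧ not (inL x)} t₂)

      y₂⊆∁X : vtabulate y₂ ⊆ complement X
      y₂⊆∁X x t = subst T (sym (Vecₚ.lookup-map x not X)) (outsideX (subst T (Vecₚ.lookup∘tabulate y₂ x) t))
        where
        outsideX : T (y₂ x) → T (not (X∋? x))
        outsideX t with T-∨⁻ {w x} t
        ... | inj₁ t₁ = proj₂ (T-∧⁻ {inL x} (w⊆ x t₁))
        ... | inj₂ t₂ = proj₂ (T-∧⁻ {vlookup Y x ∧ not (inL x)} t₂)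

      exchange : card Y + g ≤ rank indep X + rank indep (complement X)
      exchange = begin
        card Y + g                                 ≡⟨ cong (_+ g) card-Y ⟩
        countIn Y l + (P + Q) + g                  ≤⟨ +-monoˡ-≤ g (+-monoˡ-≤ (P + Q) (indep⇒≤cap Y IY l)) ⟩
        c + (P + Q) + g                            ≡⟨ +-interchange c P Q g ⟩
        (c + P) + (g + Q)                          ≡⟨ cong₂ _+_ count-y₁ count-y₂ ⟨
        count y₁ + count y₂                        ≡⟨ cong₂ _+_ (card-tabulate y₁) (card-tabulate y₂) ⟨
        card (vtabulate y₁) + card (vtabulate y₂)  ≤⟨ +-mono-≤ (rank-≥ indep X (vtabulate y₁) y₁⊆X y₁-indep)
                                                     (rank-≥ indep (complement X) (vtabulate y₂) y₂⊆∁X y₂-indep) ⟩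
        rank indep X + rank indep (complement X)   ∎
        where
        open ≤-Reasoning
        P = count (offL true)
        Q = count (offL false)
        +-interchange : ∀ a p q h → a + (p + q) + h ≡ (a + p) + (h + q)
        +-interchange = solve-∀

    conn-≥-gap : g ≤ conn indep X
    conn-≥-gap = conn-≥ indep X g ∅-indep exchange
      where
      ∅-indep : indep ∅ ≡ true
      ∅-indep = ≤cap⇒indep ∅ λ l′ → subst (_≤ cap l′)
        (sym (count-≡0 _ λ x → cong (_∧ inBlock x l′) (Vecₚ.lookup-replicate x false))) z≤n

  module _ (σ : Permutation′ n) (l : Fin m) where

    inPrefix : ℕ → Fin n → Bool
    inPrefix p x = (position σ x <ᵇ p) ∧ inBlock x l

    prefixCount : ℕ → ℕ
    prefixCount p = countIn (prefix σ p) l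

    prefixCount≡ : ∀ p → prefixCount p ≡ count (inPrefix p)
    prefixCount≡ p = count-cong λ x → cong (_∧ inBlock x l) (Vecₚ.lookup∘tabulate (λ y → position σ y <ᵇ p) x)

    prefixCount-0 : prefixCount 0 ≡ 0
    prefixCount-0 = trans (prefixCount≡ 0) (count-≡0 (inPrefix 0) λ x →
      cong (_∧ inBlock x l) (¬T⇒≡false (λ x<0 → n≮0 (<ᵇ⇒< (position σ x) 0 x<0))))

    prefixCount-n : prefixCount n ≡ card (block l)
    prefixCount-n = trans (prefixCount≡ n) (trans (count-cong λ x →
      cong (_∧ inBlock x l) (T⇒≡true (<⇒<ᵇ (Finₚ.toℕ<n (σ ⟨$⟩ˡ x))))) (sym (card-block l)))

    prefixCount-suc : ∀ p → prefixCount (suc p) ≤ suc (prefixCount p)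
    prefixCount-suc p = begin
      prefixCount (suc p)                              ≡⟨ prefixCount≡ (suc p) ⟩
      count (inPrefix (suc p))                         ≤⟨ count-mono grow ⟩
      count (λ x → inPrefix p x ∨ (position σ x ≡ᵇ p)) ≡⟨ count-∨ (inPrefix p) (λ x → position σ x ≡ᵇ p) disjoint ⟩
      count (inPrefix p) + count (λ x → position σ x ≡ᵇ p)
                                                       ≤⟨ +-monoʳ-≤ (count (inPrefix p)) (count-≤1 _ atMostOne) ⟩
      count (inPrefix p) + 1                           ≡⟨ +-comm _ 1 ⟩
      suc (count (inPrefix p))                         ≡⟨ cong suc (prefixCount≡ p) ⟨
      suc (prefixCount p)                              ∎
      where
      open ≤-Reasoning
      grow : ∀ x → T (inPrefix (suc p) x) → T (inPrefix p x ∨ (position σ x ≡ᵇ p))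
      grow x t with T-∧⁻ {position σ x <ᵇ suc p} t
      ... | x<p+1 , x∈l with m<1+n⇒m<n∨m≡n (<ᵇ⇒< (position σ x) (suc p) x<p+1)
      ...   | inj₁ x<p = Equivalence.from (Boolₚ.T-∨ {inPrefix p x}) (inj₁ (T-∧⁺ (<⇒<ᵇ x<p) x∈l))
      ...   | inj₂ x≡p = Equivalence.from (Boolₚ.T-∨ {inPrefix p x}) (inj₂ (≡⇒≡ᵇ (position σ x) p x≡p))
      disjoint : ∀ x → T (inPrefix p x) → ¬ T (position σ x ≡ᵇ p)
      disjoint x t x≡p = <-irrefl (≡ᵇ⇒≡ (position σ x) p x≡p) (<ᵇ⇒< _ _ (proj₁ (T-∧⁻ {position σ x <ᵇ p} t)))
      atMostOne : ∀ x y → T (position σ x ≡ᵇ p) → T (position σ y ≡ᵇ p) → x ≡ y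
      atMostOne x y x≡p y≡p = trans (sym (inverseʳ σ)) (trans
        (cong (σ ⟨$⟩ʳ_) (Finₚ.toℕ-injective (trans (≡ᵇ⇒≡ (position σ x) p x≡p) (sym (≡ᵇ⇒≡ (position σ y) p y≡p)))))
        (inverseʳ σ))

  gap≤pwOf : ∀ σ l → gap l ≤ pwOf indep σ
  gap≤pwOf σ l with cap l ≤? card (block l)
  ... | no c≰b rewrite m≤n⇒m∸n≡0 (<⇒≤ (≰⇒> c≰b)) | ⊓-zeroʳ (cap l) = z≤n
  ... | yes c≤b with discrete-ivt (prefixCount σ l) (cap l) n (prefixCount-0 σ l) (prefixCount-suc σ l)
                       (subst (cap l ≤_) (sym (prefixCount-n σ l)) c≤b)
  ...   | zero  , _   , F0≡c rewrite sym F0≡c | prefixCount-0 σ l = z≤n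
  ...   | suc q , q<n , Fq≡c = ≤-trans (Exchange.conn-≥-gap (prefix σ (suc q)) l Fq≡c c≤b)
          (≤-maxList _ _ (∈ₚ.∈-map⁺ (λ i → conn indep (prefix σ (suc i))) (∈ₚ.∈-upTo⁺ q<n)))

theorem4p13 : {n : ℕ} (M : PartitionMatroid n) (k : ℕ) →
    IsPathwidth (PartitionMatroid.indep M) k →
    Σ (Permutation′ n) (λ σ →
      (ddWidth BDD (PartitionMatroid.indep M) σ ≤ suc k) ×
      (ddWidth BDD (bases (PartitionMatroid.indep M)) σ ≤ suc k) ×
      (ddWidth ZDD (PartitionMatroid.indep M) σ ≤ suc k) ×
      (ddWidth ZDD (bases (PartitionMatroid.indep M)) σ ≤ suc k))
theorem4p13 {n} M k ((σ₀ , pw≡k) , _) =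
  σ , ddWidth-≤ BDD indep σ (suc k) (λ i → ≤-trans (indepBDD-width i) (widthBound≤1+k i))
    , basesWidth BDD
    , ddWidth-≤ ZDD indep σ (suc k) (λ i → ≤-trans (indepZDD-width i) (widthBound≤1+k i))
    , basesWidth ZDD
  where
  open Blocks M
  σ = proj₁ (blockSorted blk)
  open PartitionWidths M σ (proj₂ (blockSorted blk))

  widthBound≤1+k : ∀ i → widthBound i ≤ suc k
  widthBound≤1+k i = s≤s (subst (gap (blk (σ ⟨$⟩ʳ i)) ≤_) pw≡k (PathwidthBound.gap≤pwOf M σ₀ (blk (σ ⟨$⟩ʳ i))))

  basesWidth : ∀ κ → ddWidth κ (bases indep) σ ≤ suc k
  basesWidth κ = ddWidth-≤ κ (bases indep) σ (suc k) λ i →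
    subst (_≤ suc k) (sym (levelWidth-resp-≗ κ (bases indep) isBasis σ i bases≗isBasis))
      (≤-trans (basis-width i κ) (widthBound≤1+k i))
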